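{- For every even integer $k \geq 4$, every odd integer $u \geq 3$ and every positive integer $g \equiv 0 \pmod k$, there exists a $k$-ARCS of $(K_u \times K_g)(2)$.
   Context: For graphs $G,H$, the tensor product $G \times H$ has vertex set $V(G)\times V(H)$, with $(g_1,h_1)$ adjacent to $(g_2,h_2)$ iff $g_1g_2 \in E(G)$ and $h_1h_2 \in E(H)$. For a graph $G$ and positive integer $\lambda$, $G(\lambda)$ is the multigraph obtained by replacing each edge of $G$ by $\lambda$ parallel edges. $K_n$ is the complete graph on $n$ vertices. $(K_u \times K_g)(\lambda)$ is regarded as a $u$-partite multigraph with partite sets $V_i = \{i\}\times V(K_g)$, $i=1,\dots,u$. A partial $C_k$-factor of $(K_u \times K_g)(\lambda)$ is a subgraph which, for some $i$, is a spanning subgraph of $(K_u \times K_g)(\lambda)\setminus V_i$ all of whose components are cycles of length $k$. A $k$-ARCS of $(K_u \times K_g)(\lambda)$ is a partition of its edge multiset into partial $C_k$-factors. -}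

module Defs where

open import Data.Nat using (ℕ; zero; suc; _+_)
open import Data.Fin using (Fin)
open import Data.Fin.Properties using () renaming (_≟_ to _≟F_)
open import Data.Product using (Σ; ∃; _×_; _,_; proj₁; proj₂)
open import Data.Product.Properties using (≡-dec)
open import Data.Sum using (_⊎_)
open import Data.List using (List; []; _∷_; _++_; [_]; zip; length; filter; concat; map)
open import Data.Nat.ListAction using (sum)
open import Data.List.Relation.Unary.All using (All)
open import Data.List.Relation.Unary.Unique.Propositional using (Unique)
open import Data.List.Membership.Propositional using (_∈_)
open import Relation.Nullary using (¬_; Dec)
open import Relation.Nullary.Decidable using (_⊎-dec_; _×-dec_)
open import Relation.Binary.PropositionalEquality using (_≡_; _≢_)

-- Vertices of K_u × K_g : pairs (i , a) with i ∈ Fin u (partite index) and a ∈ Fin g.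
Vtx : ℕ → ℕ → Set
Vtx u g = Fin u × Fin g

_≟V_ : ∀ {u g} (x y : Vtx u g) → Dec (x ≡ y)
_≟V_ = ≡-dec _≟F_ _≟F_

Adj : ∀ {u g} → Vtx u g → Vtx u g → Set
Adj (i , a) (j , b) = (i ≢ j) × (a ≢ b)

-- A closed walk given by its cyclic vertex sequence x0 x1 ... x_{m-1};
-- its edges are x0x1, x1x2, ..., x_{m-1}x0.
cycleEdges : ∀ {A : Set} → List A → List (A × A)
cycleEdges [] = []
cycleEdges (x ∷ xs) = zip (x ∷ xs) (xs ++ [ x ])

record IsCycle (k u g : ℕ) (c : List (Vtx u g)) : Set where
  field
    len      : length c ≡ k
    distinct : Unique c
    adjacent : All (λ e → Adj (proj₁ e) (proj₂ e)) (cycleEdges c)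

occ : ∀ {u g} → Vtx u g → List (Vtx u g) → ℕ
occ v xs = length (filter (v ≟V_) xs)

record IsPartialFactor (k u g : ℕ) (i : Fin u) (cs : List (List (Vtx u g))) : Set where
  field
    cycles   : All (IsCycle k u g) cs
    missing  : ∀ (v : Vtx u g) → proj₁ v ≡ i → occ v (concat cs) ≡ 0
    covering : ∀ (v : Vtx u g) → proj₁ v ≢ i → occ v (concat cs) ≡ 1

PartialFactor : ℕ → ℕ → ℕ → Set
PartialFactor k u g = Σ (Fin u) λ i → Σ (List (List (Vtx u g))) λ cs → IsPartialFactor k u g i cs

matches? : ∀ {u g} (x y : Vtx u g) (e : Vtx u g × Vtx u g) →
           Dec (((proj₁ e ≡ x) × (proj₂ e ≡ y)) ⊎ ((proj₁ e ≡ y) × (proj₂ e ≡ x)))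
matches? x y (p , q) = ((p ≟V x) ×-dec (q ≟V y)) ⊎-dec ((p ≟V y) ×-dec (q ≟V x))

edgeUse : ∀ {u g} (x y : Vtx u g) → List (List (Vtx u g)) → ℕ
edgeUse x y cs = sum (map (λ c → length (filter (matches? x y) (cycleEdges c))) cs)

totalEdgeUse : ∀ {k u g} (x y : Vtx u g) → List (PartialFactor k u g) → ℕ
totalEdgeUse x y fs = sum (map (λ f → edgeUse x y (proj₁ (proj₂ f))) fs)

-- A k-ARCS of (K_u × K_g)(λ): a list of partial C_k-factors which together use
-- every edge of K_u × K_g exactly λ times (i.e. partition the edge multiset).
-- (Cycles only use edges of K_u × K_g by IsCycle.adjacent.)
ARCS : ℕ → ℕ → ℕ → ℕ → Set
ARCS k u g λ′ = Σ (List (PartialFactor k u g)) λ fs →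
  ∀ (x y : Vtx u g) → Adj x y → totalEdgeUse x y fs ≡ λ′

-- Write k = 2m, u = 2w + 1 and g = rk, and split the g vertices of a part into r blocks of
-- k positions. The partial factors are indexed by a missing part t and a type φ < g − 1.
-- Such a factor pairs part t + s with part t − s (1 ≤ s ≤ w) and covers each pair by 2r
-- k-cycles alternating between the two parts: for φ < k − 1 the cycles stay inside a block
-- and follow a rotational 2-factorisation of K_{k,k} − I on Z_(k-1) ∪ {∞}; the other
-- (r − 1)k types join block P to block P + σ, shifting positions by d.
-- An edge between parts i ≠ j lies in the pair of parts centred at t = (i + j)/2 and is met
-- there by two distinct types. The u(g − 1) factors offer exactly 2|E(K_u × K_g)| edge
-- slots, so "used at least twice" already means "used exactly twice"; the same counting
-- turns "every vertex outside V_t is covered" into "covered exactly once".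

module Submission where

open import Defs
open import Data.Nat using (ℕ; zero; suc; _+_; _*_; _∸_; _≤_; _<_; z≤n; s≤s; s≤s⁻¹; NonZero; _/_; _%_; _<?_)
open import Data.Nat.Properties
open import Data.Nat.DivMod
open import Data.Nat.Divisibility using (_∣_; divides)
open import Data.Nat.Solver using (module +-*-Solver)
open import Data.Fin using (Fin; zero; suc; toℕ; combine; remQuot)
  renaming (_≟_ to _≟F_)
open import Data.Fin.Properties
  using (toℕ<n; toℕ-injective; toℕ-fromℕ<; fromℕ<-toℕ; fromℕ<-cong; combine-injectiveˡ; combine-injectiveʳ; combine-remQuot)
open import Data.Product using (Σ; _×_; _,_; proj₁; proj₂)
open import Data.Sum using (_⊎_; inj₁; inj₂)
open import Data.List using (List; []; _∷_; _++_; [_]; zip; length; filter; concat; map; applyUpTo)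
open import Data.List.Properties using (length-++; filter-++; length-applyUpTo; concat-++)
open import Data.Nat.ListAction using (sum)
open import Data.List.Relation.Unary.All as All using (All; []; _∷_)
open import Data.List.Relation.Unary.All.Properties using (concat⁺; applyUpTo⁺₁; applyUpTo⁺₂)
open import Data.List.Relation.Unary.Any using (here; there)
open import Data.List.Relation.Unary.Unique.Propositional using (Unique)
open import Data.List.Relation.Unary.AllPairs using ([]; _∷_)
open import Data.List.Membership.Propositional using (_∈_)
open import Data.List.Membership.Propositional.Properties using (∈-concat⁺′; ∈-applyUpTo⁺)
open import Data.Empty using (⊥-elim)
open import Data.Unit using (⊤; tt)
open import Function using (_∘_)
open import Relation.Nullary using (¬_; Dec; yes; no; ¬?)
open import Relation.Nullary.Decidable using (_×-dec_)
open import Relation.Binary.PropositionalEquality hiding ([_])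
open +-*-Solver

iverson : ∀ {p} {P : Set p} → Dec P → ℕ
iverson (yes _) = 1
iverson (no _)  = 0

iverson-yes : ∀ {p} {P : Set p} → P → (d : Dec P) → iverson d ≡ 1
iverson-yes _ (yes _) = refl
iverson-yes p (no ¬p) = ⊥-elim (¬p p)

iverson-no : ∀ {p} {P : Set p} → ¬ P → (d : Dec P) → iverson d ≡ 0
iverson-no ¬p (yes p) = ⊥-elim (¬p p)
iverson-no _  (no _)  = refl

iverson-cong : ∀ {p q} {P : Set p} {Q : Set q} → (P → Q) → (Q → P) →
               (d : Dec P) (e : Dec Q) → iverson d ≡ iverson e
iverson-cong f g (yes p) e = sym (iverson-yes (f p) e)
iverson-cong f g (no ¬p) e = sym (iverson-no (¬p ∘ g) e)

iverson≤1 : ∀ {p} {P : Set p} (d : Dec P) → iverson d ≤ 1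
iverson≤1 (yes _) = s≤s z≤n
iverson≤1 (no _)  = z≤n

iverson-× : ∀ {a b} {A : Set a} {B : Set b} (d : Dec (A × B)) (dA : Dec A) (dB : Dec B) →
            iverson d ≡ iverson dA * iverson dB
iverson-× d (yes a) (yes b) = iverson-yes (a , b) d
iverson-× d (yes a) (no ¬b) = iverson-no (¬b ∘ proj₂) d
iverson-× d (no ¬a) dB      = iverson-no (¬a ∘ proj₁) d

iverson-⊎ : ∀ {a b} {A : Set a} {B : Set b} (d : Dec (A ⊎ B)) (dA : Dec A) (dB : Dec B) →
            ¬ (A × B) → iverson d ≡ iverson dA + iverson dB
iverson-⊎ d (yes a) (yes b)  disj = ⊥-elim (disj (a , b))
iverson-⊎ d (yes a) (no _)   _    = iverson-yes (inj₁ a) d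
iverson-⊎ d (no _)  (yes b)  _    = iverson-yes (inj₂ b) d
iverson-⊎ d (no ¬a) (no ¬b)  _    = iverson-no (λ { (inj₁ a) → ¬a a ; (inj₂ b) → ¬b b }) d

iverson+iverson-¬ : ∀ {a} {A : Set a} (d : Dec A) → iverson d + iverson (¬? d) ≡ 1
iverson+iverson-¬ (yes _) = refl
iverson+iverson-¬ (no _)  = refl

length-filter-∷ : ∀ {a p} {A : Set a} {P : A → Set p} (P? : ∀ x → Dec (P x)) x xs →
                  length (filter P? (x ∷ xs)) ≡ iverson (P? x) + length (filter P? xs)
length-filter-∷ P? x xs with P? x
... | yes _ = refl
... | no _  = refl

1≤length-filter : ∀ {a p} {A : Set a} {P : A → Set p} (P? : ∀ x → Dec (P x)) {x} xs →
                  x ∈ xs → P x → 1 ≤ length (filter P? xs)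
1≤length-filter P? (y ∷ xs) (here refl) px
  rewrite length-filter-∷ P? y xs | iverson-yes px (P? y) = s≤s z≤n
1≤length-filter P? (y ∷ xs) (there x∈) px
  rewrite length-filter-∷ P? y xs = ≤-trans (1≤length-filter P? xs x∈ px) (m≤n+m _ _)

∑ : ∀ n → (Fin n → ℕ) → ℕ
∑ zero    f = 0
∑ (suc n) f = f zero + ∑ n (f ∘ suc)

∑-cong : ∀ n {f h : Fin n → ℕ} → (∀ i → f i ≡ h i) → ∑ n f ≡ ∑ n h
∑-cong zero    eq = refl
∑-cong (suc n) eq = cong₂ _+_ (eq zero) (∑-cong n (eq ∘ suc))

∑-+ : ∀ n (f h : Fin n → ℕ) → ∑ n (λ i → f i + h i) ≡ ∑ n f + ∑ n h
∑-+ zero    f h = refl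
∑-+ (suc n) f h rewrite ∑-+ n (f ∘ suc) (h ∘ suc) =
  solve 4 (λ a b c d → (a :+ b) :+ (c :+ d) := (a :+ c) :+ (b :+ d)) refl
    (f zero) (h zero) (∑ n (f ∘ suc)) (∑ n (h ∘ suc))

∑-*ˡ : ∀ n c (f : Fin n → ℕ) → ∑ n (λ i → c * f i) ≡ c * ∑ n f
∑-*ˡ zero    c f = sym (*-zeroʳ c)
∑-*ˡ (suc n) c f rewrite ∑-*ˡ n c (f ∘ suc) = sym (*-distribˡ-+ c (f zero) _)

∑-*ʳ : ∀ n c (f : Fin n → ℕ) → ∑ n (λ i → f i * c) ≡ ∑ n f * c
∑-*ʳ n c f = trans (∑-cong n (λ i → *-comm (f i) c)) (trans (∑-*ˡ n c f) (*-comm c _))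

∑-const : ∀ n c → ∑ n (λ _ → c) ≡ n * c
∑-const zero    c = refl
∑-const (suc n) c = cong (c +_) (∑-const n c)

∑-mono : ∀ n {f h : Fin n → ℕ} → (∀ i → h i ≤ f i) → ∑ n h ≤ ∑ n f
∑-mono zero    le = z≤n
∑-mono (suc n) le = +-mono-≤ (le zero) (∑-mono n (le ∘ suc))

∑-≥-≡⇒≡ : ∀ n {f h : Fin n → ℕ} → (∀ i → h i ≤ f i) → ∑ n f ≡ ∑ n h → ∀ i → f i ≡ h i
∑-≥-≡⇒≡ (suc n) {f} {h} le eq zero =
  ≤-antisym (+-cancelʳ-≤ (∑ n (f ∘ suc)) (f zero) (h zero)
              (≤-trans (≤-reflexive eq) (+-monoʳ-≤ (h zero) (∑-mono n (le ∘ suc)))))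
            (le zero)
∑-≥-≡⇒≡ (suc n) {f} {h} le eq (suc i) = ∑-≥-≡⇒≡ n (le ∘ suc) tail-eq i
  where
  tail-eq : ∑ n (f ∘ suc) ≡ ∑ n (h ∘ suc)
  tail-eq = ≤-antisym (+-cancelˡ-≤ (f zero) _ _ (≤-trans (≤-reflexive eq) (+-monoˡ-≤ _ (le zero))))
                      (∑-mono n (le ∘ suc))

∑-≟ : ∀ n (j : Fin n) → ∑ n (λ i → iverson (i ≟F j)) ≡ 1
∑-≟ (suc n) zero = cong suc (trans (∑-cong n (λ i → iverson-no (λ ()) (suc i ≟F zero)))
                                   (trans (∑-const n 0) (*-zeroʳ n)))
∑-≟ (suc n) (suc j) =
  trans (cong (_+ ∑ n (λ i → iverson (suc i ≟F suc j))) (iverson-no (λ ()) (zero ≟F suc j)))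
        (trans (∑-cong n shift) (∑-≟ n j))
  where
  shift : ∀ (i : Fin n) → iverson (suc i ≟F suc j) ≡ iverson (i ≟F j)
  shift i = iverson-cong Data.Fin.Properties.suc-injective (cong suc) (suc i ≟F suc j) (i ≟F j)

∑-≢ : ∀ n (j : Fin n) → ∑ n (λ i → iverson (¬? (j ≟F i))) ≡ n ∸ 1
∑-≢ n@(suc n-1) j = +-cancelˡ-≡ 1 _ _ (begin
  1 + ∑ n (λ i → iverson (¬? (j ≟F i)))
    ≡⟨ cong (_+ ∑ n (λ i → iverson (¬? (j ≟F i)))) (sym (trans (∑-cong n flip) (∑-≟ n j))) ⟩
  ∑ n (λ i → iverson (j ≟F i)) + ∑ n (λ i → iverson (¬? (j ≟F i)))
    ≡⟨ sym (∑-+ n (λ i → iverson (j ≟F i)) (λ i → iverson (¬? (j ≟F i)))) ⟩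
  ∑ n (λ i → iverson (j ≟F i) + iverson (¬? (j ≟F i)))
    ≡⟨ ∑-cong n (λ i → iverson+iverson-¬ (j ≟F i)) ⟩
  ∑ n (λ _ → 1)
    ≡⟨ trans (∑-const n 1) (*-identityʳ n) ⟩
  n ∎)
  where
  open ≡-Reasoning
  flip : ∀ i → iverson (j ≟F i) ≡ iverson (i ≟F j)
  flip i = iverson-cong sym sym (j ≟F i) (i ≟F j)

0%n≡0 : ∀ n .{{_ : NonZero n}} → 0 % n ≡ 0
0%n≡0 (suc n) = refl

_⊖[_]_ : ℕ → (n : ℕ) → .{{NonZero n}} → ℕ → ℕ
x ⊖[ n ] y = (x + (n ∸ y % n)) % n

module _ {n : ℕ} .{{_ : NonZero n}} where

  %-≡-+* : ∀ a b p q → a + p * n ≡ b + q * n → a % n ≡ b % n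
  %-≡-+* a b p q eq =
    trans (sym ([m+kn]%n≡m%n a p n)) (trans (cong (_% n) eq) ([m+kn]%n≡m%n b q n))

  %-congˡ-+ : ∀ {a a'} b → a % n ≡ a' % n → (a + b) % n ≡ (a' + b) % n
  %-congˡ-+ {a} {a'} b eq = trans (%-distribˡ-+ a b n)
    (trans (cong (λ z → (z + b % n) % n) eq) (sym (%-distribˡ-+ a' b n)))

  %-congʳ-+ : ∀ a {b b'} → b % n ≡ b' % n → (a + b) % n ≡ (a + b') % n
  %-congʳ-+ a {b} {b'} eq = trans (%-distribˡ-+ a b n)
    (trans (cong (λ z → (a % n + z) % n) eq) (sym (%-distribˡ-+ a b' n)))

  [n∸a%n]+a≡[1+a/n]*n : ∀ a → (n ∸ a % n) + a ≡ (1 + a / n) * n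
  [n∸a%n]+a≡[1+a/n]*n a = begin
    (n ∸ a % n) + a                     ≡⟨ cong ((n ∸ a % n) +_) (m≡m%n+[m/n]*n a n) ⟩
    (n ∸ a % n) + (a % n + (a / n) * n) ≡⟨ sym (+-assoc (n ∸ a % n) (a % n) _) ⟩
    ((n ∸ a % n) + a % n) + (a / n) * n ≡⟨ cong (_+ (a / n) * n) (m∸n+n≡m (<⇒≤ (m%n<n a n))) ⟩
    n + (a / n) * n                     ∎
    where open ≡-Reasoning

  %-cancelˡ-+ : ∀ a {b c} → (a + b) % n ≡ (a + c) % n → b % n ≡ c % n
  %-cancelˡ-+ a {b} {c} eq = trans (sym (undo b)) (trans (%-congʳ-+ (n ∸ a % n) eq) (undo c))
    where
    undo : ∀ b → ((n ∸ a % n) + (a + b)) % n ≡ b % n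
    undo b = %-≡-+* _ b 0 (1 + a / n) (begin
      (n ∸ a % n) + (a + b) + 0 ≡⟨ +-identityʳ _ ⟩
      (n ∸ a % n) + (a + b)     ≡⟨ sym (+-assoc (n ∸ a % n) a b) ⟩
      (n ∸ a % n) + a + b       ≡⟨ cong (_+ b) ([n∸a%n]+a≡[1+a/n]*n a) ⟩
      (1 + a / n) * n + b       ≡⟨ +-comm _ b ⟩
      b + (1 + a / n) * n       ∎)
      where open ≡-Reasoning

  [a%n+c]%n≡[a+c]%n : ∀ a c → (a % n + c) % n ≡ (a + c) % n
  [a%n+c]%n≡[a+c]%n a c = %-congˡ-+ {a % n} {a} c (m%n%n≡m%n a n)

  ⊖<n : ∀ x y → x ⊖[ n ] y < n
  ⊖<n x y = m%n<n _ n

  +-⊖ : ∀ x y → (y + x ⊖[ n ] y) % n ≡ x % n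
  +-⊖ x y = trans (%-congʳ-+ y (m%n%n≡m%n (x + (n ∸ y % n)) n)) (%-≡-+* _ x 0 (1 + y / n) (begin
    y + (x + (n ∸ y % n)) + 0 ≡⟨ +-identityʳ _ ⟩
    y + (x + (n ∸ y % n))     ≡⟨ cong (y +_) (+-comm x _) ⟩
    y + ((n ∸ y % n) + x)     ≡⟨ sym (+-assoc y _ x) ⟩
    y + (n ∸ y % n) + x       ≡⟨ cong (_+ x) (trans (+-comm y _) ([n∸a%n]+a≡[1+a/n]*n y)) ⟩
    (1 + y / n) * n + x       ≡⟨ +-comm _ x ⟩
    x + (1 + y / n) * n       ∎))
    where open ≡-Reasoning

  ⊖-+ : ∀ x y → (x ⊖[ n ] y + y) % n ≡ x % n
  ⊖-+ x y = trans (cong (_% n) (+-comm (x ⊖[ n ] y) y)) (+-⊖ x y)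

  ⊖≡0⇒%≡% : ∀ x y → x ⊖[ n ] y ≡ 0 → x % n ≡ y % n
  ⊖≡0⇒%≡% x y eq = trans (sym (⊖-+ x y)) (cong (λ z → (z + y) % n) eq)

  %-+-cancelˡ-≢ : ∀ a {c} → 0 < c → c < n → (a + c) % n ≢ a % n
  %-+-cancelˡ-≢ a {c} 0<c c<n eq = <⇒≢ 0<c (sym (begin
    c         ≡⟨ sym (m<n⇒m%n≡m c<n) ⟩
    c % n     ≡⟨ %-cancelˡ-+ a (trans eq (cong (_% n) (sym (+-identityʳ a)))) ⟩
    0 % n     ≡⟨ 0%n≡0 n ⟩
    0         ∎))
    where open ≡-Reasoning

module Counting (k u g : ℕ) where

  V : Set
  V = Vtx u g

  ∑V : (V → ℕ) → ℕ
  ∑V F = ∑ u (λ i → ∑ g (λ a → F (i , a)))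

  ∑V-cong : ∀ {F H : V → ℕ} → (∀ v → F v ≡ H v) → ∑V F ≡ ∑V H
  ∑V-cong eq = ∑-cong u (λ i → ∑-cong g (λ a → eq (i , a)))

  ∑V-mono : ∀ {F H : V → ℕ} → (∀ v → H v ≤ F v) → ∑V H ≤ ∑V F
  ∑V-mono le = ∑-mono u (λ i → ∑-mono g (λ a → le (i , a)))

  ∑V-≥-≡⇒≡ : ∀ {F H : V → ℕ} → (∀ v → H v ≤ F v) → ∑V F ≡ ∑V H → ∀ v → F v ≡ H v
  ∑V-≥-≡⇒≡ le eq (i , a) =
    ∑-≥-≡⇒≡ g (λ a → le (i , a)) (∑-≥-≡⇒≡ u (λ i → ∑-mono g (λ a → le (i , a))) eq i) a

  ∑V-+ : ∀ (F H : V → ℕ) → ∑V (λ v → F v + H v) ≡ ∑V F + ∑V H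
  ∑V-+ F H = trans (∑-cong u (λ i → ∑-+ g _ _)) (∑-+ u _ _)

  ∑V-0 : ∑V (λ _ → 0) ≡ 0
  ∑V-0 = trans (∑-cong u (λ i → trans (∑-const g 0) (*-zeroʳ g)))
               (trans (∑-const u 0) (*-zeroʳ u))

  ∑V-*ˡ : ∀ c (F : V → ℕ) → ∑V (λ v → c * F v) ≡ c * ∑V F
  ∑V-*ˡ c F = trans (∑-cong u (λ i → ∑-*ˡ g c _)) (∑-*ˡ u c _)

  ∑V-sum : ∀ {A : Set} (F : V → A → ℕ) (xs : List A) →
           ∑V (λ v → sum (map (F v) xs)) ≡ sum (map (λ a → ∑V (λ v → F v a)) xs)
  ∑V-sum F []       = ∑V-0
  ∑V-sum F (a ∷ xs) = trans (∑V-+ (λ v → F v a) _) (cong (∑V (λ v → F v a) +_) (∑V-sum F xs))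

  ∑V-≟ : ∀ (x : V) → ∑V (λ v → iverson (v ≟V x)) ≡ 1
  ∑V-≟ (i₀ , a₀) =
    trans (∑-cong u (λ i → trans (∑-cong g (λ a → split i a))
                                 (trans (∑-*ˡ g (iverson (i ≟F i₀)) (λ a → iverson (a ≟F a₀)))
                                        (cong (iverson (i ≟F i₀) *_) (∑-≟ g a₀)))))
          (trans (∑-cong u (λ i → *-identityʳ _)) (∑-≟ u i₀))
    where
    split : ∀ i a → iverson ((i , a) ≟V (i₀ , a₀)) ≡ iverson (i ≟F i₀) * iverson (a ≟F a₀)
    split i a = trans (iverson-cong (λ { refl → refl , refl }) (λ { (refl , refl) → refl })
                                    ((i , a) ≟V (i₀ , a₀)) ((i ≟F i₀) ×-dec (a ≟F a₀)))
                      (iverson-× _ (i ≟F i₀) (a ≟F a₀))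

  ∑V-outside : ∀ (i : Fin u) → ∑V (λ v → iverson (¬? (i ≟F proj₁ v))) ≡ (u ∸ 1) * g
  ∑V-outside i = trans (∑-cong u (λ j → trans (∑-const g _) (*-comm g _)))
                       (trans (∑-*ʳ u g _) (cong (_* g) (∑-≢ u i)))

  occ-∷ : ∀ (v x : V) xs → occ v (x ∷ xs) ≡ iverson (v ≟V x) + occ v xs
  occ-∷ v x xs = length-filter-∷ (v ≟V_) x xs

  occ-++ : ∀ (v : V) xs ys → occ v (xs ++ ys) ≡ occ v xs + occ v ys
  occ-++ v xs ys = trans (cong length (filter-++ (v ≟V_) xs ys)) (length-++ (filter (v ≟V_) xs))

  ∑V-occ : ∀ (xs : List V) → ∑V (λ v → occ v xs) ≡ length xs
  ∑V-occ []       = ∑V-0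
  ∑V-occ (x ∷ xs) = trans (∑V-cong (λ v → occ-∷ v x xs))
                          (trans (∑V-+ _ _) (cong₂ _+_ (∑V-≟ x) (∑V-occ xs)))

  ∈⇒1≤occ : ∀ (v : V) {xs} → v ∈ xs → 1 ≤ occ v xs
  ∈⇒1≤occ v {xs} v∈ = 1≤length-filter (v ≟V_) xs v∈ refl

  occ≤1⇒Unique : ∀ (xs : List V) → (∀ v → occ v xs ≤ 1) → Unique xs
  occ≤1⇒Unique []       _  = []
  occ≤1⇒Unique (x ∷ xs) le = All.tabulate x∉xs ∷ occ≤1⇒Unique xs (λ v → ≤-trans (occ≤ v) (le v))
    where
    occ≤ : ∀ v → occ v xs ≤ occ v (x ∷ xs)
    occ≤ v rewrite occ-∷ v x xs = m≤n+m _ _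
    x∉xs : ∀ {y} → y ∈ xs → x ≢ y
    x∉xs {y} y∈ refl with le x
    ... | h rewrite occ-∷ x x xs | iverson-yes refl (x ≟V x) = ≤⇒≯ h (s≤s (∈⇒1≤occ x y∈))

  occ≤occ-concat : ∀ (v : V) (cs : List (List V)) → All (λ c → occ v c ≤ occ v (concat cs)) cs
  occ≤occ-concat v []       = []
  occ≤occ-concat v (c ∷ cs) rewrite occ-++ v c (concat cs) =
    m≤m+n _ _ ∷ All.map (λ le → ≤-trans le (m≤n+m _ _)) (occ≤occ-concat v cs)

  IsClosedWalk : List V → Set
  IsClosedWalk c = length c ≡ k × All (λ e → Adj (proj₁ e) (proj₂ e)) (cycleEdges c)

  partialFactor-fromCover : ∀ (i : Fin u) (cs : List (List V)) → All IsClosedWalk cs →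
    (∀ v → proj₁ v ≢ i → v ∈ concat cs) → length (concat cs) ≡ (u ∸ 1) * g →
    IsPartialFactor k u g i cs
  partialFactor-fromCover i cs walks cover len = record
    { cycles   = All.zipWith toCycle (walks , occ≤1)
    ; missing  = λ v eq → trans (exact v) (iverson-no (λ ne → ne (sym eq)) _)
    ; covering = λ v ne → trans (exact v) (iverson-yes (λ eq → ne (sym eq)) _)
    }
    where
    outside : V → ℕ
    outside v = iverson (¬? (i ≟F proj₁ v))
    outside≤occ : ∀ v → outside v ≤ occ v (concat cs)
    outside≤occ v with i ≟F proj₁ v
    ... | yes _ = z≤n
    ... | no ne = ∈⇒1≤occ v (cover v (λ eq → ne (sym eq)))
    exact : ∀ v → occ v (concat cs) ≡ outside v
    exact = ∑V-≥-≡⇒≡ outside≤occ (trans (∑V-occ (concat cs)) (trans len (sym (∑V-outside i))))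
    occ≤1 : All (λ c → ∀ v → occ v c ≤ 1) cs
    occ≤1 = All.tabulate (λ c∈ v → ≤-trans (All.lookup (occ≤occ-concat v cs) c∈)
                                           (≤-trans (≤-reflexive (exact v)) (iverson≤1 _)))
    toCycle : ∀ {c} → IsClosedWalk c × (∀ v → occ v c ≤ 1) → IsCycle k u g c
    toCycle ((l , a) , o) = record { len = l ; distinct = occ≤1⇒Unique _ o ; adjacent = a }

  timesUsed : V → V → List (V × V) → ℕ
  timesUsed x y es = length (filter (matches? x y) es)

  ∑V² : (V → V → ℕ) → ℕ
  ∑V² F = ∑V (λ x → ∑V (λ y → F x y))

  ∑V²-cong : ∀ {F H : V → V → ℕ} → (∀ x y → F x y ≡ H x y) → ∑V² F ≡ ∑V² H
  ∑V²-cong eq = ∑V-cong (λ x → ∑V-cong (eq x))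

  ∑V²-+ : ∀ (F H : V → V → ℕ) → ∑V² (λ x y → F x y + H x y) ≡ ∑V² F + ∑V² H
  ∑V²-+ F H = trans (∑V-cong (λ x → ∑V-+ (F x) (H x))) (∑V-+ _ _)

  ∑V²-0 : ∑V² (λ _ _ → 0) ≡ 0
  ∑V²-0 = trans (∑V-cong (λ _ → ∑V-0)) ∑V-0

  ∑V²-sum : ∀ {A : Set} (F : V → V → A → ℕ) (xs : List A) →
            ∑V² (λ x y → sum (map (F x y) xs)) ≡ sum (map (λ a → ∑V² (λ x y → F x y a)) xs)
  ∑V²-sum F xs = trans (∑V-cong (λ x → ∑V-sum (F x) xs)) (∑V-sum (λ x a → ∑V (λ y → F x y a)) xs)

  ∑V²-≟×≟ : ∀ (p q : V) → ∑V² (λ x y → iverson (x ≟V p) * iverson (y ≟V q)) ≡ 1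
  ∑V²-≟×≟ p q = trans (∑V-cong (λ x → trans (∑V-*ˡ (iverson (x ≟V p)) (λ y → iverson (y ≟V q)))
                                             (trans (cong (iverson (x ≟V p) *_) (∑V-≟ q)) (*-identityʳ _))))
                      (∑V-≟ p)

  ∑V²-matches : ∀ (p q : V) → p ≢ q → ∑V² (λ x y → iverson (matches? x y (p , q))) ≡ 2
  ∑V²-matches p q p≢q = trans (∑V²-cong split) (trans (∑V²-+ _ _) (cong₂ _+_ (∑V²-≟×≟ p q) (∑V²-≟×≟ q p)))
    where
    sym² : ∀ {A : Set} {a b c d : A} → a ≡ b × c ≡ d → b ≡ a × d ≡ c
    sym² (e , e′) = sym e , sym e′
    swap-sym² : ∀ {A : Set} {a b c d : A} → a ≡ b × c ≡ d → d ≡ c × b ≡ a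
    swap-sym² (e , e′) = sym e′ , sym e
    split : ∀ x y → iverson (matches? x y (p , q))
                  ≡ iverson (x ≟V p) * iverson (y ≟V q) + iverson (x ≟V q) * iverson (y ≟V p)
    split x y =
      trans (iverson-⊎ (matches? x y (p , q)) ((p ≟V x) ×-dec (q ≟V y)) ((p ≟V y) ×-dec (q ≟V x))
                       (λ { ((refl , refl) , (p≡q , _)) → p≢q p≡q }))
            (cong₂ _+_
              (trans (iverson-cong sym² sym² ((p ≟V x) ×-dec (q ≟V y)) ((x ≟V p) ×-dec (y ≟V q)))
                     (iverson-× ((x ≟V p) ×-dec (y ≟V q)) (x ≟V p) (y ≟V q)))
              (trans (iverson-cong swap-sym² swap-sym²
                                   ((p ≟V y) ×-dec (q ≟V x)) ((x ≟V q) ×-dec (y ≟V p)))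
                     (iverson-× ((x ≟V q) ×-dec (y ≟V p)) (x ≟V q) (y ≟V p))))

  ∑V²-timesUsed : ∀ (es : List (V × V)) → All (λ e → proj₁ e ≢ proj₂ e) es →
                  ∑V² (λ x y → timesUsed x y es) ≡ 2 * length es
  ∑V²-timesUsed []             _          = ∑V²-0
  ∑V²-timesUsed ((p , q) ∷ es) (p≢q ∷ ne) =
    trans (∑V²-cong (λ x y → length-filter-∷ (matches? x y) (p , q) es))
          (trans (∑V²-+ _ _) (trans (cong₂ _+_ (∑V²-matches p q p≢q) (∑V²-timesUsed es ne))
                                    (sym (*-distribˡ-+ 2 1 (length es)))))

  length-zip : ∀ {A B : Set} (xs : List A) (ys : List B) → length ys ≡ length xs →
               length (zip xs ys) ≡ length xs
  length-zip []       ys       eq = refl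
  length-zip (x ∷ xs) []       ()
  length-zip (x ∷ xs) (y ∷ ys) eq = cong suc (length-zip xs ys (suc-injective eq))

  length-cycleEdges : ∀ (c : List V) → length (cycleEdges c) ≡ length c
  length-cycleEdges []       = refl
  length-cycleEdges (x ∷ xs) =
    length-zip (x ∷ xs) (xs ++ [ x ]) (trans (length-++ xs) (+-comm (length xs) 1))

  ∑V²-edgeUse : ∀ (cs : List (List V)) → All (IsCycle k u g) cs →
                ∑V² (λ x y → edgeUse x y cs) ≡ 2 * length (concat cs)
  ∑V²-edgeUse []       _          = ∑V²-0
  ∑V²-edgeUse (c ∷ cs) (isC ∷ isCs) = begin
    ∑V² (λ x y → timesUsed x y (cycleEdges c) + edgeUse x y cs)
      ≡⟨ ∑V²-+ _ _ ⟩
    ∑V² (λ x y → timesUsed x y (cycleEdges c)) + ∑V² (λ x y → edgeUse x y cs)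
      ≡⟨ cong₂ _+_ (∑V²-timesUsed (cycleEdges c) (All.map loopless (IsCycle.adjacent isC)))
                   (∑V²-edgeUse cs isCs) ⟩
    2 * length (cycleEdges c) + 2 * length (concat cs)
      ≡⟨ cong (λ l → 2 * l + 2 * length (concat cs)) (length-cycleEdges c) ⟩
    2 * length c + 2 * length (concat cs)
      ≡⟨ sym (*-distribˡ-+ 2 (length c) _) ⟩
    2 * (length c + length (concat cs))
      ≡⟨ cong (2 *_) (sym (length-++ c)) ⟩
    2 * length (concat (c ∷ cs)) ∎
    where
    open ≡-Reasoning
    loopless : ∀ {e : V × V} → Adj (proj₁ e) (proj₂ e) → proj₁ e ≢ proj₂ e
    loopless adj eq = proj₁ adj (cong proj₁ eq)

  adj? : (x y : V) → Dec (Adj x y)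
  adj? (i , a) (j , b) = ¬? (i ≟F j) ×-dec ¬? (a ≟F b)

  ∑V²-adj : ∑V² (λ x y → iverson (adj? x y)) ≡ u * (g * ((u ∸ 1) * (g ∸ 1)))
  ∑V²-adj = trans (∑V-cong degree) (trans (∑-cong u (λ i → ∑-const g _)) (∑-const u _))
    where
    degree : ∀ (x : V) → ∑V (λ y → iverson (adj? x y)) ≡ (u ∸ 1) * (g ∸ 1)
    degree (i , a) =
      trans (∑-cong u (λ j → trans (∑-cong g (λ b → iverson-× _ (¬? (i ≟F j)) (¬? (a ≟F b))))
                                   (trans (∑-*ˡ g (iverson (¬? (i ≟F j))) (λ b → iverson (¬? (a ≟F b))))
                                          (cong (iverson (¬? (i ≟F j)) *_) (∑-≢ g a)))))
            (trans (∑-*ʳ u (g ∸ 1) (λ j → iverson (¬? (i ≟F j)))) (cong (_* (g ∸ 1)) (∑-≢ u i)))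

  cyclesOf : PartialFactor k u g → List (List V)
  cyclesOf f = proj₁ (proj₂ f)

  totalLength : List (PartialFactor k u g) → ℕ
  totalLength fs = sum (map (λ f → length (concat (cyclesOf f))) fs)

  arcs-fromLowerBound : ∀ (fs : List (PartialFactor k u g)) →
    (∀ x y → Adj x y → 2 ≤ totalEdgeUse x y fs) →
    totalLength fs ≡ u * (g * ((u ∸ 1) * (g ∸ 1))) →
    ARCS k u g 2
  arcs-fromLowerBound fs twice len = fs , λ x y adj → trans (exact x y) (cong (2 *_) (iverson-yes adj (adj? x y)))
    where
    used : V → V → ℕ
    used x y = totalEdgeUse x y fs
    target : V → V → ℕ
    target x y = 2 * iverson (adj? x y)
    target≤used : ∀ x y → target x y ≤ used x y
    target≤used x y with adj? x y
    ... | yes adj = twice x y adj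
    ... | no _    = z≤n
    slots : ∀ (fs′ : List (PartialFactor k u g)) →
      sum (map (λ f → ∑V² (λ x y → edgeUse x y (cyclesOf f))) fs′) ≡ 2 * totalLength fs′
    slots []        = refl
    slots (f ∷ fs′) =
      trans (cong₂ _+_ (∑V²-edgeUse (cyclesOf f) (IsPartialFactor.cycles (proj₂ (proj₂ f)))) (slots fs′))
            (sym (*-distribˡ-+ 2 (length (concat (cyclesOf f))) (totalLength fs′)))
    totals : ∑V² used ≡ ∑V² target
    totals = begin
      ∑V² used                                   ≡⟨ ∑V²-sum (λ x y f → edgeUse x y (cyclesOf f)) fs ⟩
      sum (map (λ f → ∑V² (λ x y → edgeUse x y (cyclesOf f))) fs) ≡⟨ slots fs ⟩
      2 * totalLength fs                         ≡⟨ cong (2 *_) (trans len (sym ∑V²-adj)) ⟩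
      2 * ∑V² (λ x y → iverson (adj? x y))       ≡⟨ sym (trans (∑V-cong (λ x → ∑V-*ˡ 2 _)) (∑V-*ˡ 2 _)) ⟩
      ∑V² target                                 ∎
      where open ≡-Reasoning
    exact : ∀ x y → used x y ≡ target x y
    exact x y = ∑V-≥-≡⇒≡ (target≤used x) (∑V-≥-≡⇒≡ (λ x → ∑V-mono (target≤used x)) totals x) y

module _ {A : Set} where

  alternating : (ℕ → A) → (ℕ → A) → ℕ → List A
  alternating a b zero    = []
  alternating a b (suc n) = a 0 ∷ b 0 ∷ alternating (a ∘ suc) (b ∘ suc) n

  alternatingEdges : (ℕ → A) → (ℕ → A) → A → ℕ → List (A × A)
  alternatingEdges a b z zero    = (a 0 , b 0) ∷ (b 0 , z) ∷ []
  alternatingEdges a b z (suc n) = (a 0 , b 0) ∷ (b 0 , a 1) ∷ alternatingEdges (a ∘ suc) (b ∘ suc) z n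

  cycleEdges-alternating : ∀ n a b → cycleEdges (alternating a b (suc n)) ≡ alternatingEdges a b (a 0) n
  cycleEdges-alternating n a b = go n a b (a 0)
    where
    go : ∀ n a b z → zip (alternating a b (suc n)) (b 0 ∷ (alternating (a ∘ suc) (b ∘ suc) n ++ [ z ]))
                   ≡ alternatingEdges a b z n
    go zero    a b z = refl
    go (suc n) a b z = cong (λ es → (a 0 , b 0) ∷ (b 0 , a 1) ∷ es) (go n (a ∘ suc) (b ∘ suc) z)

  length-alternating : ∀ n a b → length (alternating a b n) ≡ n * 2
  length-alternating zero    a b = refl
  length-alternating (suc n) a b = cong (λ l → suc (suc l)) (length-alternating n (a ∘ suc) (b ∘ suc))

  All-alternatingEdges : ∀ {P : A × A → Set} n a b z →
    (∀ l → P (a l , b l)) → (∀ l → P (b l , a (suc l))) → a (suc n) ≡ z →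
    All P (alternatingEdges a b z n)
  All-alternatingEdges {P} zero a b z pab pba eq = pab 0 ∷ subst (λ q → P (b 0 , q)) eq (pba 0) ∷ []
  All-alternatingEdges (suc n) a b z pab pba eq =
    pab 0 ∷ pba 0 ∷ All-alternatingEdges n (a ∘ suc) (b ∘ suc) z (pab ∘ suc) (pba ∘ suc) eq

  ∈-alternatingEdges-ab : ∀ n a b (z : A) l → l ≤ n → (a l , b l) ∈ alternatingEdges a b z n
  ∈-alternatingEdges-ab zero    a b z zero    _         = here refl
  ∈-alternatingEdges-ab (suc n) a b z zero    _         = here refl
  ∈-alternatingEdges-ab (suc n) a b z (suc l) (s≤s l≤n) =
    there (there (∈-alternatingEdges-ab n (a ∘ suc) (b ∘ suc) z l l≤n))

  ∈-alternatingEdges-ba : ∀ n a b (z : A) l → l ≤ n → a (suc n) ≡ z →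
                          (b l , a (suc l)) ∈ alternatingEdges a b z n
  ∈-alternatingEdges-ba zero    a b z zero    _         eq = there (here (cong (b 0 ,_) eq))
  ∈-alternatingEdges-ba (suc n) a b z zero    _         eq = there (here refl)
  ∈-alternatingEdges-ba (suc n) a b z (suc l) (s≤s l≤n) eq =
    there (there (∈-alternatingEdges-ba n (a ∘ suc) (b ∘ suc) z l l≤n eq))

  ∈-alternating-a : ∀ n a b l → l < n → a l ∈ alternating a b n
  ∈-alternating-a (suc n) a b zero    _         = here refl
  ∈-alternating-a (suc n) a b (suc l) (s≤s l<n) = there (there (∈-alternating-a n (a ∘ suc) (b ∘ suc) l l<n))

  ∈-alternating-b : ∀ n a b l → l < n → b l ∈ alternating a b n
  ∈-alternating-b (suc n) a b zero    _         = there (here refl)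
  ∈-alternating-b (suc n) a b (suc l) (s≤s l<n) = there (there (∈-alternating-b n (a ∘ suc) (b ∘ suc) l l<n))

  length-concat-applyUpTo : ∀ (f : ℕ → List A) c n → (∀ i → length (f i) ≡ c) →
                            length (concat (applyUpTo f n)) ≡ n * c
  length-concat-applyUpTo f c zero    eq = refl
  length-concat-applyUpTo f c (suc n) eq =
    trans (length-++ (f 0)) (cong₂ _+_ (eq 0) (length-concat-applyUpTo (f ∘ suc) c n (eq ∘ suc)))

  length-concat²-applyUpTo : ∀ (f : ℕ → List (List A)) c n → (∀ i → length (concat (f i)) ≡ c) →
                             length (concat (concat (applyUpTo f n))) ≡ n * c
  length-concat²-applyUpTo f c zero    eq = refl
  length-concat²-applyUpTo f c (suc n) eq =
    trans (cong length (sym (concat-++ (f 0) (concat (applyUpTo (f ∘ suc) n)))))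
          (trans (length-++ (concat (f 0)))
                 (cong₂ _+_ (eq 0) (length-concat²-applyUpTo (f ∘ suc) c n (eq ∘ suc))))

  sum-map-concat : ∀ (h : A → ℕ) (xss : List (List A)) →
                   sum (map h (concat xss)) ≡ sum (map (λ xs → sum (map h xs)) xss)
  sum-map-concat h []         = refl
  sum-map-concat h (xs ∷ xss) = trans (sum-map-++ xs) (cong (sum (map h xs) +_) (sum-map-concat h xss))
    where
    sum-map-++ : ∀ (xs : List A) {ys} → sum (map h (xs ++ ys)) ≡ sum (map h xs) + sum (map h ys)
    sum-map-++ []       = refl
    sum-map-++ (x ∷ xs) = trans (cong (h x +_) (sum-map-++ xs)) (sym (+-assoc (h x) _ _))

  ≤-sum-map : ∀ (h : A → ℕ) {x} xs → x ∈ xs → h x ≤ sum (map h xs)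
  ≤-sum-map h (y ∷ xs) (here refl) = m≤m+n _ _
  ≤-sum-map h (y ∷ xs) (there x∈) = ≤-trans (≤-sum-map h xs x∈) (m≤n+m _ _)

  +-≤-sum-map-applyUpTo : ∀ (h : A → ℕ) (f : ℕ → A) n i j → i < n → j < n → i ≢ j →
                          h (f i) + h (f j) ≤ sum (map h (applyUpTo f n))
  +-≤-sum-map-applyUpTo h f (suc n) zero    zero    _         _         i≢j = ⊥-elim (i≢j refl)
  +-≤-sum-map-applyUpTo h f (suc n) zero    (suc j) _         (s≤s j<n) _   =
    +-monoʳ-≤ (h (f 0)) (≤-sum-map h _ (∈-applyUpTo⁺ (f ∘ suc) j<n))
  +-≤-sum-map-applyUpTo h f (suc n) (suc i) zero    (s≤s i<n) _         _   =
    ≤-trans (≤-reflexive (+-comm (h (f (suc i))) _)) (+-monoʳ-≤ (h (f 0)) (≤-sum-map h _ (∈-applyUpTo⁺ (f ∘ suc) i<n)))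
  +-≤-sum-map-applyUpTo h f (suc n) (suc i) (suc j) (s≤s i<n) (s≤s j<n) i≢j =
    ≤-trans (+-≤-sum-map-applyUpTo h (f ∘ suc) n i j i<n j<n (i≢j ∘ cong suc)) (m≤n+m _ _)

  sum-map-const : ∀ (h : A → ℕ) c xs → All (λ x → h x ≡ c) xs → sum (map h xs) ≡ length xs * c
  sum-map-const h c []       []       = refl
  sum-map-const h c (x ∷ xs) (e ∷ es) = cong₂ _+_ e (sum-map-const h c xs es)

even⊎odd : ∀ n → Σ ℕ (λ i → n ≡ i * 2 ⊎ n ≡ suc (i * 2))
even⊎odd zero = 0 , inj₁ refl
even⊎odd (suc n) with even⊎odd n
... | i , inj₁ eq = i , inj₂ (cong suc eq)
... | i , inj₂ eq = suc i , inj₁ (cong suc eq)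

module _ {n : ℕ} .{{_ : NonZero n}} where

  mod-cong : ∀ a b → a % n ≡ b % n → a mod n ≡ b mod n
  mod-cong a b eq = fromℕ<-cong _ _ eq (m%n<n a n) (m%n<n b n)

  mod-injective : ∀ a b → a mod n ≡ b mod n → a % n ≡ b % n
  mod-injective a b eq =
    trans (sym (toℕ-fromℕ< (m%n<n a n))) (trans (cong toℕ eq) (toℕ-fromℕ< (m%n<n b n)))

  toℕ-mod : ∀ (i : Fin n) → toℕ i mod n ≡ i
  toℕ-mod i = trans (fromℕ<-cong _ _ (m<n⇒m%n≡m (toℕ<n i)) (m%n<n (toℕ i) n) (toℕ<n i))
                    (fromℕ<-toℕ i (toℕ<n i))

module Construction (m₀ w r₀ : ℕ) where

  m k k-1 u r g g-1 : ℕ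
  m   = suc (suc m₀)
  k   = m * 2
  k-1 = k ∸ 1
  u   = suc (w * 2)
  r   = suc r₀
  g   = r * k
  g-1 = g ∸ 1

  open Counting k u g

  -- Fin g is split into r blocks of k positions: (P , x) ↦ P * k + x.
  vertex : ℕ → ℕ → ℕ → V
  vertex p P x = p mod u , combine (P mod r) (x mod k)

  vertex-cong : ∀ {p P x p′ P′ x′} → p % u ≡ p′ % u → P % r ≡ P′ % r → x % k ≡ x′ % k →
                vertex p P x ≡ vertex p′ P′ x′
  vertex-cong {p} {P} {x} {p′} {P′} {x′} e₁ e₂ e₃ =
    cong₂ _,_ (mod-cong p p′ e₁) (cong₂ combine (mod-cong P P′ e₂) (mod-cong x x′ e₃))

  partOf blockOf positionOf : V → ℕ
  partOf     v = toℕ (proj₁ v)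
  blockOf    v = toℕ (proj₁ (remQuot {r} k (proj₂ v)))
  positionOf v = toℕ (proj₂ (remQuot {r} k (proj₂ v)))

  vertex-decode : ∀ (v : V) → vertex (partOf v) (blockOf v) (positionOf v) ≡ v
  vertex-decode (i , a) = cong₂ _,_ (toℕ-mod i)
    (trans (cong₂ combine (toℕ-mod {r} (proj₁ (remQuot {r} k a))) (toℕ-mod {k} (proj₂ (remQuot {r} k a))))
           (combine-remQuot {r} k a))

  vertex-adj : ∀ p P x p′ P′ x′ → p % u ≢ p′ % u → (P % r ≢ P′ % r ⊎ x % k ≢ x′ % k) →
               Adj (vertex p P x) (vertex p′ P′ x′)
  vertex-adj p P x p′ P′ x′ p≢ Px≢ = (λ e → p≢ (mod-injective p p′ e)) , second Px≢
    where
    second : (P % r ≢ P′ % r ⊎ x % k ≢ x′ % k) →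
             combine {r} {k} (P mod r) (x mod k) ≢ combine (P′ mod r) (x′ mod k)
    second (inj₁ P≢) e = P≢ (mod-injective P P′ (combine-injectiveˡ (P mod r) (x mod k) (P′ mod r) (x′ mod k) e))
    second (inj₂ x≢) e = x≢ (mod-injective x x′ (combine-injectiveʳ (P mod r) (x mod k) (P′ mod r) (x′ mod k) e))

  -- Type φ < k − 1 is the rotation `within φ`; type k − 1 + (σ − 1)k + d is `across σ d`.
  data FactorType : Set where
    across : ℕ → ℕ → FactorType
    within : ℕ → FactorType

  type′ : ℕ → FactorType
  type′ φ with φ <? k-1
  ... | yes _ = within φ
  ... | no _  = across (suc ((φ ∸ k-1) / k)) ((φ ∸ k-1) % k)

  typeOf : ℕ → FactorType
  typeOf φ = type′ (φ % g-1)

  -- Rotation j follows the zigzag ∞, j, j + 1, j − 1, j + 2, j − 2, … of positions mod k − 1,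
  -- with position k − 1 as ∞: cycle 0 puts its odd-numbered terms on the A-side, cycle 1 its
  -- even-numbered terms.
  rise fall : ℕ → ℕ → ℕ
  rise j zero    = k-1
  rise j (suc c) = (j + suc c) % k-1
  fall j c       = (j + (k-1 ∸ c)) % k-1

  up down : ℕ → ℕ → ℕ
  up   j l = rise j (l % m)
  down j l = fall j (l % m)

  posA posB : FactorType → ℕ → ℕ → ℕ
  posA (across σ d) ε       l = ε + l * 2
  posA (within j)   zero    l = up j l
  posA (within j)   (suc _) l = down j l
  posB (across σ d) ε       l = ε + l * 2 + d
  posB (within j)   zero    l = down j l
  posB (within j)   (suc _) l = up j (suc l)

  blockB : FactorType → ℕ → ℕ
  blockB (across σ d) P = P + σ
  blockB (within j)   P = P

  aVertex bVertex : ℕ → ℕ → FactorType → ℕ → ℕ → ℕ → V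
  aVertex t s τ P ε l = vertex (t + s) P (posA τ ε l)
  bVertex t s τ P ε l = vertex (t + (u ∸ s)) (blockB τ P) (posB τ ε l)

  cycle : ℕ → ℕ → FactorType → ℕ → ℕ → List V
  cycle t s τ P ε = alternating (aVertex t s τ P ε) (bVertex t s τ P ε) m

  cyclePair : ℕ → ℕ → FactorType → ℕ → List (List V)
  cyclePair t s τ P = cycle t s τ P 0 ∷ cycle t s τ P 1 ∷ []

  cycles : ℕ → ℕ → List (List V)
  cycles t φ = concat (applyUpTo (λ s → concat (applyUpTo (cyclePair t (suc s) (typeOf φ)) r)) w)

  m+m≡k : m + m ≡ k
  m+m≡k = solve 1 (λ a → (con 2 :+ a) :+ (con 2 :+ a) := (con 2 :+ a) :* con 2) refl m₀

  +<k-1 : ∀ a b → a < m → b < m → a + b < k-1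
  +<k-1 a b a<m b<m = s≤s⁻¹ (subst₂ _≤_ (cong suc (+-suc a b)) m+m≡k (+-mono-≤ a<m b<m))

  m<k-1 : m < k-1
  m<k-1 = s≤s (s≤s (s≤s (m≤m*n m₀ 2)))

  m-1<k-1 : suc m₀ < k-1
  m-1<k-1 = <-trans ≤-refl m<k-1

  t+s≢t-s : ∀ t s → 1 ≤ s → s ≤ w → (t + s) % u ≢ (t + (u ∸ s)) % u
  t+s≢t-s t s 1≤s s≤w eq = <⇒≱ s+s<u (≤-reflexive (sym s+s≡u))
    where
    s<u : s < u
    s<u = s≤s (≤-trans s≤w (m≤m*n w 2))
    s≡u-s : s ≡ u ∸ s
    s≡u-s = trans (sym (m<n⇒m%n≡m s<u))
                  (trans (%-cancelˡ-+ t eq) (m<n⇒m%n≡m (∸-monoʳ-< {u} {s} {0} 1≤s (<⇒≤ s<u))))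
    s+s≡u : s + s ≡ u
    s+s≡u = trans (cong (s +_) s≡u-s) (m+[n∸m]≡n (<⇒≤ s<u))
    s+s<u : s + s < u
    s+s<u = s≤s (≤-trans (+-mono-≤ s≤w s≤w) (≤-reflexive (solve 1 (λ a → a :+ a := a :* con 2) refl w)))

  ValidType : FactorType → Set
  ValidType (across σ d) = 1 ≤ σ × σ < r
  ValidType (within j)   = ⊤

  typeOf-valid : ∀ φ → ValidType (typeOf φ)
  typeOf-valid φ = valid (φ % g-1) (m%n<n φ g-1)
    where
    valid : ∀ φ → φ < g-1 → ValidType (type′ φ)
    valid φ φ<g-1 with φ <? k-1
    ... | yes _   = tt
    ... | no φ≮k-1 = s≤s z≤n , s≤s (m<n*o⇒m/o<n {φ ∸ k-1} {r₀} {k} φ-k+1<r₀k)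
      where
      φ-k+1<r₀k : φ ∸ k-1 < r₀ * k
      φ-k+1<r₀k = +-cancelʳ-< k-1 _ _
        (subst₂ _<_ (sym (m∸n+n≡m (≮⇒≥ φ≮k-1))) (+-comm k-1 (r₀ * k)) φ<g-1)

  rise≤k-1 : ∀ j c → rise j c ≤ k-1
  rise≤k-1 j zero    = ≤-refl
  rise≤k-1 j (suc c) = <⇒≤ (m%n<n (j + suc c) k-1)

  rise≢fall : ∀ j c → c < m → rise j c ≢ fall j c
  rise≢fall j zero    _   eq = <⇒≢ (m%n<n (j + (k-1 ∸ 0)) k-1) (sym eq)
  rise≢fall j (suc c) c<m eq =
    <⇒≢ (+<k-1 (suc c) (suc c) c<m c<m) (trans (cong (suc c +_) c≡-c) (m+[n∸m]≡n (<⇒≤ c<k-1)))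
    where
    c<k-1 : suc c < k-1
    c<k-1 = <-trans c<m m<k-1
    c≡-c : suc c ≡ k-1 ∸ suc c
    c≡-c = trans (sym (m<n⇒m%n≡m c<k-1))
                 (trans (%-cancelˡ-+ j eq) (m<n⇒m%n≡m (∸-monoʳ-< {k-1} {suc c} {0} (s≤s z≤n) (<⇒≤ c<k-1))))

  fall≢rise : ∀ j a b → a < m → b < m → fall j a ≢ rise j b
  fall≢rise j a       zero    _   _   eq = <⇒≢ (m%n<n (j + (k-1 ∸ a)) k-1) eq
  fall≢rise j zero    (suc b) _   b<m eq =
    0≢1+n (trans (sym (n%n≡0 k-1)) (trans (%-cancelˡ-+ j eq) (m<n⇒m%n≡m (<-trans b<m m<k-1))))
  fall≢rise j (suc a) (suc b) a<m b<m eq =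
    <⇒≢ (+<k-1 (suc b) (suc a) b<m a<m) (trans (cong (_+ suc a) (sym -a≡b)) (m∸n+n≡m (<⇒≤ a<k-1)))
    where
    a<k-1 : suc a < k-1
    a<k-1 = <-trans a<m m<k-1
    -a≡b : k-1 ∸ suc a ≡ suc b
    -a≡b = trans (sym (m<n⇒m%n≡m (∸-monoʳ-< {k-1} {suc a} {0} (s≤s z≤n) (<⇒≤ a<k-1))))
                 (trans (%-cancelˡ-+ j eq) (m<n⇒m%n≡m (<-trans b<m m<k-1)))

  down<k : ∀ j l → down j l < k
  down<k j l = <-trans (m%n<n (j + (k-1 ∸ l % m)) k-1) ≤-refl

  up≢down : ∀ j l → up j l % k ≢ down j l % k
  up≢down j l eq = rise≢fall j (l % m) (m%n<n l m)
    (trans (sym (m<n⇒m%n≡m (s≤s (rise≤k-1 j (l % m))))) (trans eq (m<n⇒m%n≡m (down<k j l))))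

  down≢up : ∀ j l l′ → down j l % k ≢ up j l′ % k
  down≢up j l l′ eq = fall≢rise j (l % m) (l′ % m) (m%n<n l m) (m%n<n l′ m)
    (trans (sym (m<n⇒m%n≡m (down<k j l))) (trans eq (m<n⇒m%n≡m (s≤s (rise≤k-1 j (l′ % m))))))

  P≢P+σ : ∀ σ → 1 ≤ σ → σ < r → ∀ P → P % r ≢ (P + σ) % r
  P≢P+σ σ 1≤σ σ<r P eq = %-+-cancelˡ-≢ P 1≤σ σ<r (sym eq)

  ab-separated : ∀ τ → ValidType τ → ∀ P ε l →
                 P % r ≢ blockB τ P % r ⊎ posA τ ε l % k ≢ posB τ ε l % k
  ab-separated (across σ d) (1≤σ , σ<r) P ε       l = inj₁ (P≢P+σ σ 1≤σ σ<r P)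
  ab-separated (within j)   _           P zero    l = inj₂ (up≢down j l)
  ab-separated (within j)   _           P (suc _) l = inj₂ (down≢up j l (suc l))

  ba-separated : ∀ τ → ValidType τ → ∀ P ε l →
                 blockB τ P % r ≢ P % r ⊎ posB τ ε l % k ≢ posA τ ε (suc l) % k
  ba-separated (across σ d) (1≤σ , σ<r) P ε       l = inj₁ (P≢P+σ σ 1≤σ σ<r P ∘ sym)
  ba-separated (within j)   _           P zero    l = inj₂ (down≢up j l (suc l))
  ba-separated (within j)   _           P (suc _) l = inj₂ (up≢down j (suc l))

  posA-periodic : ∀ τ ε → posA τ ε m % k ≡ posA τ ε 0 % k
  posA-periodic (across σ d) ε       = trans ([m+n]%n≡m%n ε k) (cong (_% k) (sym (+-identityʳ ε)))
  posA-periodic (within j)   zero    = cong (λ c → rise j c % k) (n%n≡0 m)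
  posA-periodic (within j)   (suc _) = cong (λ c → (j + (k-1 ∸ c)) % k-1 % k) (n%n≡0 m)

  cycle-closes : ∀ t s τ P ε → aVertex t s τ P ε m ≡ aVertex t s τ P ε 0
  cycle-closes t s τ P ε = vertex-cong {t + s} {P} {posA τ ε m} {t + s} {P} {posA τ ε 0} refl refl (posA-periodic τ ε)

  cycle-isClosedWalk : ∀ t s τ P ε → 1 ≤ s → s ≤ w → ValidType τ → IsClosedWalk (cycle t s τ P ε)
  cycle-isClosedWalk t s τ P ε 1≤s s≤w valid = length-alternating m a b ,
    subst (All (λ e → Adj (proj₁ e) (proj₂ e))) (sym (cycleEdges-alternating (suc m₀) a b))
      (All-alternatingEdges (suc m₀) a b (a 0) adj-ab adj-ba (cycle-closes t s τ P ε))
    where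
    a b : ℕ → V
    a = aVertex t s τ P ε
    b = bVertex t s τ P ε
    adj-ab : ∀ l → Adj (a l) (b l)
    adj-ab l = vertex-adj (t + s) P (posA τ ε l) (t + (u ∸ s)) (blockB τ P) (posB τ ε l)
                          (t+s≢t-s t s 1≤s s≤w) (ab-separated τ valid P ε l)
    adj-ba : ∀ l → Adj (b l) (a (suc l))
    adj-ba l = vertex-adj (t + (u ∸ s)) (blockB τ P) (posB τ ε l) (t + s) P (posA τ ε (suc l))
                          (t+s≢t-s t s 1≤s s≤w ∘ sym) (ba-separated τ valid P ε l)

  cycles-areClosedWalks : ∀ t φ → All IsClosedWalk (cycles t φ)
  cycles-areClosedWalks t φ = concat⁺ (applyUpTo⁺₁ _ w (λ {s} s<w → concat⁺ (applyUpTo⁺₁ _ r (λ {P} _ →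
    walk s P 0 s<w ∷ walk s P 1 s<w ∷ []))))
    where
    walk : ∀ s P ε → suc s ≤ w → IsClosedWalk (cycle t (suc s) (typeOf φ) P ε)
    walk s P ε s<w = cycle-isClosedWalk t (suc s) (typeOf φ) P ε (s≤s z≤n) s<w (typeOf-valid φ)

  length-cycles : ∀ t φ → length (concat (cycles t φ)) ≡ (u ∸ 1) * g
  length-cycles t φ =
    trans (length-concat²-applyUpTo (λ s → concat (applyUpTo (cyclePair t (suc s) (typeOf φ)) r)) (r * (k + (k + 0))) w
            (λ s → length-concat²-applyUpTo (cyclePair t (suc s) (typeOf φ)) (k + (k + 0)) r
                     (λ P → length-pair (suc s) P)))
          (solve 3 (λ w r k → w :* (r :* (k :+ (k :+ con 0))) := (w :* con 2) :* (r :* k)) refl w r k)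
    where
    length-pair : ∀ s P → length (concat (cyclePair t s (typeOf φ) P)) ≡ k + (k + 0)
    length-pair s P = trans (length-++ (cycle t s τ P 0) {cycle t s τ P 1 ++ []})
      (cong₂ _+_ (length-alternating m (aVertex t s τ P 0) (bVertex t s τ P 0))
                 (trans (length-++ (cycle t s τ P 1) {[]})
                        (cong (_+ 0) (length-alternating m (aVertex t s τ P 1) (bVertex t s τ P 1)))))
      where τ = typeOf φ

  ±-representative : ∀ δ → 1 ≤ δ → δ < u → Σ ℕ λ s → 1 ≤ s × s ≤ w × (s ≡ δ ⊎ u ∸ s ≡ δ)
  ±-representative δ 1≤δ δ<u with δ ≤? w
  ... | yes δ≤w = δ , 1≤δ , δ≤w , inj₁ refl
  ... | no δ≰w  = u ∸ δ , m<n⇒0<n∸m δ<u , u-δ≤w , inj₂ (m∸[m∸n]≡n (<⇒≤ δ<u))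
    where
    u-δ≤w : u ∸ δ ≤ w
    u-δ≤w = ≤-trans (∸-monoʳ-≤ u (≰⇒> δ≰w))
      (≤-reflexive (trans (cong (_∸ w) (solve 1 (λ w → w :* con 2 := w :+ w) refl w)) (m+n∸n≡m w w)))

  Reaches : ℕ → ℕ → ℕ → Set
  Reaches t s i = (t + s) % u ≡ i ⊎ (t + (u ∸ s)) % u ≡ i

  part-reached : ∀ t i → i < u → i ≢ t % u → Σ ℕ λ s → 1 ≤ s × s ≤ w × Reaches t s i
  part-reached t i i<u i≢t with ±-representative (i ⊖[ u ] t) (n≢0⇒n>0 δ≢0) (⊖<n {u} i t)
    where
    δ≢0 : i ⊖[ u ] t ≢ 0
    δ≢0 e = i≢t (trans (sym (m<n⇒m%n≡m i<u)) (⊖≡0⇒%≡% {u} i t e))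
  ... | s , 1≤s , s≤w , ±s = s , 1≤s , s≤w , Data.Sum.map (reach s) (reach (u ∸ s)) ±s
    where
    reach : ∀ s′ → s′ ≡ i ⊖[ u ] t → (t + s′) % u ≡ i
    reach s′ refl = trans (+-⊖ {u} i t) (m<n⇒m%n≡m i<u)

  Straddles : ℕ → ℕ → ℕ → ℕ → Set
  Straddles t s i j = ((t + s) % u ≡ i × (t + (u ∸ s)) % u ≡ j)
                    ⊎ ((t + s) % u ≡ j × (t + (u ∸ s)) % u ≡ i)

  -- The centre t = (i + j)(w + 1) satisfies 2t ≡ i + j since 2(w + 1) = u + 1.
  parts-straddled : ∀ i j → i < u → j < u → i ≢ j →
                    Σ ℕ λ t → Σ ℕ λ s → t < u × 1 ≤ s × s ≤ w × Straddles t s i j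
  parts-straddled i j i<u j<u i≢j = choose (±-representative δ (n≢0⇒n>0 δ≢0) (⊖<n {u} i t))
    where
    t δ : ℕ
    t = ((i + j) * suc w) % u
    δ = i ⊖[ u ] t
    t+δ≡i : (t + δ) % u ≡ i
    t+δ≡i = trans (+-⊖ {u} i t) (m<n⇒m%n≡m i<u)
    2t≡i+j : (t + t) % u ≡ (i + j) % u
    2t≡i+j = trans (sym (%-distribˡ-+ ((i + j) * suc w) ((i + j) * suc w) u))
      (%-≡-+* ((i + j) * suc w + (i + j) * suc w) (i + j) 0 (i + j)
        (solve 3 (λ i j w → (i :+ j) :* (con 1 :+ w) :+ (i :+ j) :* (con 1 :+ w) :+ con 0
                         := (i :+ j) :+ (i :+ j) :* (con 1 :+ w :* con 2)) refl i j w))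
    t-δ≡j : (t + (u ∸ δ)) % u ≡ j
    t-δ≡j = trans (%-cancelˡ-+ i {t + (u ∸ δ)} {j} (begin
      (i + (t + (u ∸ δ))) % u
        ≡⟨ %-congˡ-+ {u} {i} {t + δ} (t + (u ∸ δ)) (trans (m<n⇒m%n≡m i<u) (sym t+δ≡i)) ⟩
      ((t + δ) + (t + (u ∸ δ))) % u
        ≡⟨ cong (_% u) (solve 3 (λ t d e → (t :+ d) :+ (t :+ e) := (t :+ t) :+ (d :+ e)) refl t δ (u ∸ δ)) ⟩
      ((t + t) + (δ + (u ∸ δ))) % u
        ≡⟨ cong (λ z → (t + t + z) % u) (m+[n∸m]≡n (<⇒≤ (⊖<n {u} i t))) ⟩
      ((t + t) + u) % u
        ≡⟨ [m+n]%n≡m%n (t + t) u ⟩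
      (t + t) % u
        ≡⟨ 2t≡i+j ⟩
      (i + j) % u ∎)) (m<n⇒m%n≡m j<u)
      where open ≡-Reasoning
    δ≢0 : δ ≢ 0
    δ≢0 e = i≢j (trans (sym (subst (λ z → (t + z) % u ≡ i) e t+δ≡i))
                  (trans (trans (cong (_% u) (+-identityʳ t)) (sym ([m+n]%n≡m%n t u)))
                         (subst (λ z → (t + (u ∸ z)) % u ≡ j) e t-δ≡j)))
    choose : (Σ ℕ λ s → 1 ≤ s × s ≤ w × (s ≡ δ ⊎ u ∸ s ≡ δ)) →
             Σ ℕ λ t → Σ ℕ λ s → t < u × 1 ≤ s × s ≤ w × Straddles t s i j
    choose (s , 1≤s , s≤w , inj₁ refl) = t , s , m%n<n ((i + j) * suc w) u , 1≤s , s≤w , inj₁ (t+δ≡i , t-δ≡j)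
    choose (s , 1≤s , s≤w , inj₂ e)    = t , s , m%n<n ((i + j) * suc w) u , 1≤s , s≤w ,
      inj₂ (trans (cong (λ z → (t + z) % u) s≡u-δ) t-δ≡j , trans (cong (λ z → (t + z) % u) e) t+δ≡i)
      where
      s≡u-δ : s ≡ u ∸ δ
      s≡u-δ = trans (sym (m∸[m∸n]≡n (≤-trans s≤w (≤-trans (m≤m*n w 2) (n≤1+n _))))) (cong (u ∸_) e)

  k-1≤g-1 : k-1 ≤ g-1
  k-1≤g-1 = m≤m+n k-1 (r₀ * k)

  typeOf-within : ∀ j → j < k-1 → typeOf j ≡ within j
  typeOf-within j j<k-1 with j % g-1 | m<n⇒m%n≡m (≤-trans j<k-1 k-1≤g-1)
  ... | _ | refl with j <? k-1
  ...   | yes _    = refl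
  ...   | no j≮k-1 = ⊥-elim (j≮k-1 j<k-1)

  across-index<g-1 : ∀ σ₀ d → suc σ₀ < r → d < k → k-1 + (σ₀ * k + d) < g-1
  across-index<g-1 σ₀ d σ<r d<k = +-monoʳ-< k-1 (begin-strict
    σ₀ * k + d ≡⟨ +-comm (σ₀ * k) d ⟩
    d + σ₀ * k <⟨ +-monoˡ-< (σ₀ * k) d<k ⟩
    k + σ₀ * k ≤⟨ *-monoˡ-≤ k (s≤s⁻¹ σ<r) ⟩
    r₀ * k    ∎)
    where open ≤-Reasoning

  typeOf-across : ∀ σ₀ d → suc σ₀ < r → d < k → typeOf (k-1 + (σ₀ * k + d)) ≡ across (suc σ₀) d
  typeOf-across σ₀ d σ<r d<k
    with (k-1 + (σ₀ * k + d)) % g-1 | m<n⇒m%n≡m (across-index<g-1 σ₀ d σ<r d<k)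
  ... | _ | refl with k-1 + (σ₀ * k + d) <? k-1
  ...   | yes φ<k-1 = ⊥-elim (<⇒≱ φ<k-1 (m≤m+n k-1 _))
  ...   | no _      rewrite m+n∸m≡n k-1 (σ₀ * k + d) = cong₂ (λ a b → across (suc a) b) quotient remainder
    where
    no-carry : (σ₀ * k) % k + d % k < k
    no-carry = subst (_< k) (sym (cong₂ _+_ (m*n%n≡0 σ₀ k) (m<n⇒m%n≡m d<k))) d<k
    quotient : (σ₀ * k + d) / k ≡ σ₀
    quotient = begin
      (σ₀ * k + d) / k     ≡⟨ +-distrib-/ (σ₀ * k) d no-carry ⟩
      σ₀ * k / k + d / k   ≡⟨ cong₂ _+_ (m*n/n≡m σ₀ k) (m<n⇒m/n≡0 d<k) ⟩
      σ₀ + 0               ≡⟨ +-identityʳ σ₀ ⟩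
      σ₀                   ∎
      where open ≡-Reasoning
    remainder : (σ₀ * k + d) % k ≡ d
    remainder = trans (cong (_% k) (+-comm (σ₀ * k) d)) (trans ([m+kn]%n≡m%n d σ₀ k) (m<n⇒m%n≡m d<k))

  halve : ∀ x → x < k → Σ ℕ λ l → Σ ℕ λ ε → l < m × ε < 2 × ε + l * 2 ≡ x
  halve x x<k = x / 2 , x % 2 , m<n*o⇒m/o<n {x} {m} {2} x<k , m%n<n x 2 , sym (m≡m%n+[m/n]*n x 2)

  down-at : ∀ y c → c < m → down ((y + c) % k-1) c ≡ y % k-1
  down-at y c c<m = begin
    ((y + c) % k-1 + (k-1 ∸ c % m)) % k-1 ≡⟨ cong (λ z → ((y + c) % k-1 + (k-1 ∸ z)) % k-1) (m<n⇒m%n≡m c<m) ⟩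
    ((y + c) % k-1 + (k-1 ∸ c)) % k-1     ≡⟨ %-congˡ-+ {k-1} {(y + c) % k-1} {y + c} (k-1 ∸ c) (m%n%n≡m%n (y + c) k-1) ⟩
    (y + c + (k-1 ∸ c)) % k-1             ≡⟨ cong (_% k-1) (+-assoc y c _) ⟩
    (y + (c + (k-1 ∸ c))) % k-1           ≡⟨ cong (λ z → (y + z) % k-1) (m+[n∸m]≡n (<⇒≤ (<-trans c<m m<k-1))) ⟩
    (y + k-1) % k-1                       ≡⟨ [m+n]%n≡m%n y k-1 ⟩
    y % k-1                               ∎
    where open ≡-Reasoning

  up-suc : ∀ j c → suc c < m → up j (suc c) ≡ (j + suc c) % k-1
  up-suc j c c<m = cong (rise j) (m<n⇒m%n≡m c<m)

  up-m : ∀ j → up j m ≡ k-1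
  up-m j = cong (rise j) (n%n≡0 m)

  down-0 : ∀ y → down y 0 ≡ y % k-1
  down-0 y = [m+n]%n≡m%n y k-1

  down-m : ∀ y → down y m ≡ y % k-1
  down-m y = trans (cong (λ z → (y + (k-1 ∸ z)) % k-1) (n%n≡0 m)) (down-0 y)

  k-1∸D<m : ∀ D → m ≤ D → k-1 ∸ D < m
  k-1∸D<m D m≤D = ≤-<-trans (∸-monoʳ-≤ k-1 m≤D) (≤-<-trans (≤-reflexive k-1∸m) ≤-refl)
    where
    k-1∸m : k-1 ∸ m ≡ suc m₀
    k-1∸m = trans (cong (_∸ m) (solve 1 (λ a → con 3 :+ a :* con 2 := (con 2 :+ a) :+ (con 1 :+ a)) refl m₀))
                  (m+n∸m≡n m (suc m₀))

  down-∸ : ∀ j D → m ≤ D → D ≤ k-1 → down j (k-1 ∸ D) ≡ (j + D) % k-1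
  down-∸ j D m≤D D≤k-1 = trans (cong (λ z → (j + (k-1 ∸ z)) % k-1) (m<n⇒m%n≡m (k-1∸D<m D m≤D)))
                               (cong (λ z → (j + z) % k-1) (m∸[m∸n]≡n D≤k-1))

  CoveredA CoveredB : FactorType → ℕ → ℕ → Set
  CoveredA τ P′ x = Σ ℕ λ P → Σ ℕ λ ε → Σ ℕ λ l →
    P < r × ε < 2 × l < m × P % r ≡ P′ % r × posA τ ε l % k ≡ x % k
  CoveredB τ P′ x = Σ ℕ λ P → Σ ℕ λ ε → Σ ℕ λ l →
    P < r × ε < 2 × l < m × blockB τ P % r ≡ P′ % r × posB τ ε l % k ≡ x % k

  coveredA-within : ∀ j P′ x D → P′ < r → D < k-1 → (j + D) % k-1 ≡ x → CoveredA (within j) P′ x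
  coveredA-within j P′ x zero P′<r D<k-1 e =
    P′ , 1 , 0 , P′<r , s≤s (s≤s z≤n) , s≤s z≤n , refl ,
    cong (_% k) (trans (down-0 j) (trans (cong (_% k-1) (sym (+-identityʳ j))) e))
  coveredA-within j P′ x (suc c) P′<r D<k-1 e with suc c <? m
  ... | yes c<m = P′ , 0 , suc c , P′<r , s≤s z≤n , c<m , refl , cong (_% k) (trans (up-suc j c c<m) e)
  ... | no c≮m  = P′ , 1 , k-1 ∸ suc c , P′<r , s≤s (s≤s z≤n) , k-1∸D<m (suc c) (≮⇒≥ c≮m) , refl ,
                  cong (_% k) (trans (down-∸ j (suc c) (≮⇒≥ c≮m) (<⇒≤ D<k-1)) e)

  coveredB-within : ∀ j P′ x D → P′ < r → D < k-1 → (j + D) % k-1 ≡ x → CoveredB (within j) P′ x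
  coveredB-within j P′ x zero P′<r D<k-1 e =
    P′ , 0 , 0 , P′<r , s≤s z≤n , s≤s z≤n , refl ,
    cong (_% k) (trans (down-0 j) (trans (cong (_% k-1) (sym (+-identityʳ j))) e))
  coveredB-within j P′ x (suc c) P′<r D<k-1 e with suc c <? m
  ... | yes c<m = P′ , 1 , c , P′<r , s≤s (s≤s z≤n) , <-trans (n<1+n c) c<m , refl ,
                  cong (_% k) (trans (up-suc j c c<m) e)
  ... | no c≮m  = P′ , 0 , k-1 ∸ suc c , P′<r , s≤s z≤n , k-1∸D<m (suc c) (≮⇒≥ c≮m) , refl ,
                  cong (_% k) (trans (down-∸ j (suc c) (≮⇒≥ c≮m) (<⇒≤ D<k-1)) e)

  x≡k-1 : ∀ {x} → x < k → ¬ x < k-1 → x ≡ k-1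
  x≡k-1 x<k x≮k-1 = ≤-antisym (s≤s⁻¹ x<k) (≮⇒≥ x≮k-1)

  coveredA : ∀ τ P′ x → P′ < r → x < k → CoveredA τ P′ x
  coveredA (across σ d) P′ x P′<r x<k with halve x x<k
  ... | l , ε , l<m , ε<2 , e = P′ , ε , l , P′<r , ε<2 , l<m , refl , cong (_% k) e
  coveredA (within j) P′ x P′<r x<k with x <? k-1
  ... | yes x<k-1 = coveredA-within j P′ x (x ⊖[ k-1 ] j) P′<r (⊖<n {k-1} x j)
                                    (trans (+-⊖ {k-1} x j) (m<n⇒m%n≡m x<k-1))
  ... | no x≮k-1  = P′ , 0 , 0 , P′<r , s≤s z≤n , s≤s z≤n , refl , cong (_% k) (sym (x≡k-1 x<k x≮k-1))

  coveredB : ∀ τ P′ x → P′ < r → x < k → CoveredB τ P′ x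
  coveredB (across σ d) P′ x P′<r x<k with halve (x ⊖[ k ] d) (⊖<n {k} x d)
  ... | l , ε , l<m , ε<2 , e =
    P′ ⊖[ r ] σ , ε , l , ⊖<n {r} P′ σ , ε<2 , l<m , ⊖-+ {r} P′ σ ,
    trans (%-congˡ-+ {k} {ε + l * 2} {x ⊖[ k ] d} d (cong (_% k) e)) (⊖-+ {k} x d)
  coveredB (within j) P′ x P′<r x<k with x <? k-1
  ... | yes x<k-1 = coveredB-within j P′ x (x ⊖[ k-1 ] j) P′<r (⊖<n {k-1} x j)
                                    (trans (+-⊖ {k-1} x j) (m<n⇒m%n≡m x<k-1))
  ... | no x≮k-1  = P′ , 1 , suc m₀ , P′<r , s≤s (s≤s z≤n) , ≤-refl , refl ,
                    cong (_% k) (trans (up-m j) (sym (x≡k-1 x<k x≮k-1)))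

  cycle∈cycles : ∀ t φ s P ε → 1 ≤ s → s ≤ w → P < r → ε < 2 → cycle t s (typeOf φ) P ε ∈ cycles t φ
  cycle∈cycles t φ (suc s) P ε _ s<w P<r ε<2 =
    ∈-concat⁺′ (∈-concat⁺′ (∈-pair ε ε<2) (∈-applyUpTo⁺ (cyclePair t (suc s) (typeOf φ)) P<r))
               (∈-applyUpTo⁺ (λ s → concat (applyUpTo (cyclePair t (suc s) (typeOf φ)) r)) s<w)
    where
    ∈-pair : ∀ ε → ε < 2 → cycle t (suc s) (typeOf φ) P ε ∈ cyclePair t (suc s) (typeOf φ) P
    ∈-pair zero          _                 = here refl
    ∈-pair (suc zero)    _                 = there (here refl)
    ∈-pair (suc (suc _)) (s≤s (s≤s ()))

  cycles-cover : ∀ t φ (v : V) → proj₁ v ≢ t mod u → v ∈ concat (cycles t φ)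
  cycles-cover t φ v v∉V_t = subst (_∈ concat (cycles t φ)) (vertex-decode v)
                                   (reach (part-reached t i i<u i≢t))
    where
    i P′ x : ℕ
    i  = partOf v
    P′ = blockOf v
    x  = positionOf v
    i<u : i < u
    i<u = toℕ<n (proj₁ v)
    i≢t : i ≢ t % u
    i≢t eq = v∉V_t (trans (sym (toℕ-mod (proj₁ v))) (mod-cong i t (trans (m<n⇒m%n≡m i<u) eq)))
    τ : FactorType
    τ = typeOf φ
    P′<r : P′ < r
    P′<r = toℕ<n (proj₁ (remQuot {r} k (proj₂ v)))
    x<k : x < k
    x<k = toℕ<n (proj₂ (remQuot {r} k (proj₂ v)))
    reach : (Σ ℕ λ s → 1 ≤ s × s ≤ w × Reaches t s i) → vertex i P′ x ∈ concat (cycles t φ)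
    reach (s , 1≤s , s≤w , inj₁ e) with coveredA τ P′ x P′<r x<k
    ... | P , ε , l , P<r , ε<2 , l<m , eP , ex =
      subst (_∈ concat (cycles t φ))
            (vertex-cong {t + s} {P} {posA τ ε l} {i} {P′} {x} (trans e (sym (m<n⇒m%n≡m i<u))) eP ex)
            (∈-concat⁺′ (∈-alternating-a m (aVertex t s τ P ε) (bVertex t s τ P ε) l l<m)
                        (cycle∈cycles t φ s P ε 1≤s s≤w P<r ε<2))
    reach (s , 1≤s , s≤w , inj₂ e) with coveredB τ P′ x P′<r x<k
    ... | P , ε , l , P<r , ε<2 , l<m , eP , ex =
      subst (_∈ concat (cycles t φ))
            (vertex-cong {t + (u ∸ s)} {blockB τ P} {posB τ ε l} {i} {P′} {x} (trans e (sym (m<n⇒m%n≡m i<u))) eP ex)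
            (∈-concat⁺′ (∈-alternating-b m (aVertex t s τ P ε) (bVertex t s τ P ε) l l<m)
                        (cycle∈cycles t φ s P ε 1≤s s≤w P<r ε<2))

  factor : ℕ → ℕ → PartialFactor k u g
  factor t φ = t mod u , cycles t φ ,
    partialFactor-fromCover (t mod u) (cycles t φ) (cycles-areClosedWalks t φ) (cycles-cover t φ) (length-cycles t φ)

  data Realises (τ : FactorType) (Pa xa Pb xb : ℕ) : Set where
    as-ab : ∀ P ε l → P < r → ε < 2 → l < m →
            P % r ≡ Pa % r → posA τ ε l % k ≡ xa % k →
            blockB τ P % r ≡ Pb % r → posB τ ε l % k ≡ xb % k → Realises τ Pa xa Pb xb
    as-ba : ∀ P ε l → P < r → ε < 2 → l < m →
            P % r ≡ Pa % r → posA τ ε (suc l) % k ≡ xa % k →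
            blockB τ P % r ≡ Pb % r → posB τ ε l % k ≡ xb % k → Realises τ Pa xa Pb xb

  RealisedTwice : ℕ → ℕ → ℕ → ℕ → Set
  RealisedTwice Pa xa Pb xb = Σ ℕ λ φ₁ → Σ ℕ λ φ₂ → φ₁ < g-1 × φ₂ < g-1 × φ₁ ≢ φ₂ ×
    Realises (typeOf φ₁) Pa xa Pb xb × Realises (typeOf φ₂) Pa xa Pb xb

  0<2 : 0 < 2
  0<2 = s≤s z≤n

  1<2 : 1 < 2
  1<2 = s≤s (s≤s z≤n)

  -- Type (σ , d) realises the B − A position differences d (as a_l b_l) and d − 2 (as b_l a_(l+1)).
  realisedTwice-across : ∀ Pa xa Pb xb σ₀ → Pa < r → xa < k → suc σ₀ < r →
                         (Pa + suc σ₀) % r ≡ Pb % r → RealisedTwice Pa xa Pb xb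
  realisedTwice-across Pa xa Pb xb σ₀ Pa<r xa<k σ<r Pb≡ =
    φ₁ , φ₂ , across-index<g-1 σ₀ d₁ σ<r d₁<k , across-index<g-1 σ₀ d₂ σ<r d₂<k , φ₁≢φ₂ ,
    subst (λ τ → Realises τ Pa xa Pb xb) (sym (typeOf-across σ₀ d₁ σ<r d₁<k)) realised₁ ,
    subst (λ τ → Realises τ Pa xa Pb xb) (sym (typeOf-across σ₀ d₂ σ<r d₂<k)) realised₂
    where
    d₁ d₂ φ₁ φ₂ : ℕ
    d₁ = xb ⊖[ k ] xa
    d₂ = (d₁ + 2) % k
    φ₁ = k-1 + (σ₀ * k + d₁)
    φ₂ = k-1 + (σ₀ * k + d₂)
    d₁<k : d₁ < k
    d₁<k = ⊖<n {k} xb xa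
    d₂<k : d₂ < k
    d₂<k = m%n<n (d₁ + 2) k
    φ₁≢φ₂ : φ₁ ≢ φ₂
    φ₁≢φ₂ e = %-+-cancelˡ-≢ d₁ {2} 0<2 (s≤s (s≤s (s≤s z≤n)))
      (trans (sym d₁≡d₂) (sym (m<n⇒m%n≡m d₁<k)))
      where
      d₁≡d₂ : d₁ ≡ d₂
      d₁≡d₂ = +-cancelˡ-≡ (σ₀ * k) _ _ (+-cancelˡ-≡ k-1 _ _ e)
    xa+d₁≡xb : (xa + d₁) % k ≡ xb % k
    xa+d₁≡xb = +-⊖ {k} xb xa
    realised₁ : Realises (across (suc σ₀) d₁) Pa xa Pb xb
    realised₁ with halve xa xa<k
    ... | l , ε , l<m , ε<2 , e =
      as-ab Pa ε l Pa<r ε<2 l<m refl (cong (_% k) e) Pb≡ (trans (cong (λ z → (z + d₁) % k) e) xa+d₁≡xb)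
    y : ℕ
    y = xa ⊖[ k ] 2
    realised₂ : Realises (across (suc σ₀) d₂) Pa xa Pb xb
    realised₂ with halve y (⊖<n {k} xa 2)
    ... | l , ε , l<m , ε<2 , e = as-ba Pa ε l Pa<r ε<2 l<m refl
      (trans (cong (_% k) (trans (solve 2 (λ ε l → ε :+ (con 2 :+ l :* con 2) := (ε :+ l :* con 2) :+ con 2) refl ε l)
                                 (cong (_+ 2) e)))
             (⊖-+ {k} xa 2))
      Pb≡
      (begin
        (ε + l * 2 + d₂) % k   ≡⟨ cong (λ z → (z + d₂) % k) e ⟩
        (y + d₂) % k           ≡⟨ %-congʳ-+ y {d₂} {d₁ + 2} (m%n%n≡m%n (d₁ + 2) k) ⟩
        (y + (d₁ + 2)) % k     ≡⟨ cong (_% k) (solve 2 (λ y d → y :+ (d :+ con 2) := (y :+ con 2) :+ d) refl y d₁) ⟩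
        (y + 2 + d₁) % k       ≡⟨ %-congˡ-+ {k} {y + 2} {xa} d₁ (⊖-+ {k} xa 2) ⟩
        (xa + d₁) % k          ≡⟨ xa+d₁≡xb ⟩
        xb % k                 ∎)
      where open ≡-Reasoning

  realisedTwice-acrossBlocks : ∀ Pa xa Pb xb → Pa < r → Pb < r → xa < k → Pa ≢ Pb →
                               RealisedTwice Pa xa Pb xb
  realisedTwice-acrossBlocks Pa xa Pb xb Pa<r Pb<r xa<k Pa≢Pb = go (Pb ⊖[ r ] Pa) refl (⊖<n {r} Pb Pa)
    where
    go : ∀ σ → Pb ⊖[ r ] Pa ≡ σ → σ < r → RealisedTwice Pa xa Pb xb
    go zero    e _   = ⊥-elim (Pa≢Pb (trans (sym (m<n⇒m%n≡m Pa<r))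
                                      (trans (sym (⊖≡0⇒%≡% {r} Pb Pa e)) (m<n⇒m%n≡m Pb<r))))
    go (suc σ₀) e σ<r = realisedTwice-across Pa xa Pb xb σ₀ Pa<r xa<k σ<r
                         (trans (cong (λ z → (Pa + z) % r) (sym e)) (+-⊖ {r} Pb Pa))

  realisedTwice-within : ∀ {Pa xa Pb xb} j₁ j₂ → j₁ < k-1 → j₂ < k-1 → j₁ ≢ j₂ →
    Realises (within j₁) Pa xa Pb xb → Realises (within j₂) Pa xa Pb xb → RealisedTwice Pa xa Pb xb
  realisedTwice-within {Pa} {xa} {Pb} {xb} j₁ j₂ j₁<k-1 j₂<k-1 j₁≢j₂ real₁ real₂ =
    j₁ , j₂ , ≤-trans j₁<k-1 k-1≤g-1 , ≤-trans j₂<k-1 k-1≤g-1 , j₁≢j₂ ,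
    subst (λ τ → Realises τ Pa xa Pb xb) (sym (typeOf-within j₁ j₁<k-1)) real₁ ,
    subst (λ τ → Realises τ Pa xa Pb xb) (sym (typeOf-within j₂ j₂<k-1)) real₂

  down-rotated : ∀ x c → x < k-1 → c < m → down ((x + c) % k-1) c % k ≡ x % k
  down-rotated x c x<k-1 c<m = cong (_% k) (trans (down-at x c c<m) (m<n⇒m%n≡m x<k-1))

  rotation≢ : ∀ j c → 0 < c → c < k-1 → j < k-1 → j ≢ (j + c) % k-1
  rotation≢ j c 0<c c<k-1 j<k-1 e = %-+-cancelˡ-≢ j 0<c c<k-1 (trans (sym e) (sym (m<n⇒m%n≡m j<k-1)))

  -- In rotation j, cycle 0 joins the A-position ∞ to the B-positions j (as a_0 b_0) and
  -- j − (m − 1) (as b_(m-1) a_m); cycle 1 treats the B-position ∞ symmetrically.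
  realisedTwice-from∞ : ∀ P xb → P < r → xb < k-1 → RealisedTwice P k-1 P xb
  realisedTwice-from∞ P xb P<r xb<k-1 =
    realisedTwice-within xb j₂ xb<k-1 (m%n<n (xb + suc m₀) k-1) (rotation≢ xb (suc m₀) (s≤s z≤n) m-1<k-1 xb<k-1)
      (as-ab P 0 0 P<r 0<2 (s≤s z≤n) refl refl refl (cong (_% k) (trans (down-0 xb) (m<n⇒m%n≡m xb<k-1))))
      (as-ba P 0 (suc m₀) P<r 0<2 ≤-refl refl (cong (_% k) (up-m j₂)) refl (down-rotated xb (suc m₀) xb<k-1 ≤-refl))
    where
    j₂ : ℕ
    j₂ = (xb + suc m₀) % k-1

  realisedTwice-to∞ : ∀ P xa → P < r → xa < k-1 → RealisedTwice P xa P k-1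
  realisedTwice-to∞ P xa P<r xa<k-1 =
    realisedTwice-within xa j₂ xa<k-1 (m%n<n (xa + suc m₀) k-1) (rotation≢ xa (suc m₀) (s≤s z≤n) m-1<k-1 xa<k-1)
      (as-ba P 1 (suc m₀) P<r 1<2 ≤-refl refl (cong (_% k) (trans (down-m xa) (m<n⇒m%n≡m xa<k-1)))
             refl (cong (_% k) (up-m xa)))
      (as-ab P 1 (suc m₀) P<r 1<2 ≤-refl refl (down-rotated xa (suc m₀) xa<k-1 ≤-refl) refl (cong (_% k) (up-m j₂)))
    where
    j₂ : ℕ
    j₂ = (xa + suc m₀) % k-1

  up-rotated : ∀ x a c → suc c < m → up ((x + a) % k-1) (suc c) ≡ (x + a + suc c) % k-1
  up-rotated x a c c<m = trans (up-suc _ c c<m) ([a%n+c]%n≡[a+c]%n {k-1} (x + a) (suc c))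

  -- A pair of finite positions at difference D = xb − xa in Z_(k-1) is joined in rotation
  -- xa + ⌊D/2⌋ (cycle 1) and in rotation xb + ⌊(k-1-D)/2⌋ (cycle 0).
  module FinitePositions {P xa xb D : ℕ} (P<r : P < r) (xa<k-1 : xa < k-1) (xb<k-1 : xb < k-1)
                         (D<k-1 : D < k-1) (xa+D≡xb : (xa + D) % k-1 ≡ xb % k-1) where

    xa+a+b≡xb : ∀ a b → a + b ≡ D → (xa + a + b) % k-1 ≡ xb
    xa+a+b≡xb a b a+b≡D = trans (cong (_% k-1) (trans (+-assoc xa a b) (cong (xa +_) a+b≡D)))
                               (trans xa+D≡xb (m<n⇒m%n≡m xb<k-1))

    xb+a+b≡xa : ∀ a b → D + (a + b) ≡ k-1 → (xb + a + b) % k-1 ≡ xa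
    xb+a+b≡xa a b D+a+b≡k-1 = begin
      (xb + a + b) % k-1          ≡⟨ cong (_% k-1) (+-assoc xb a b) ⟩
      (xb + (a + b)) % k-1        ≡⟨ %-congˡ-+ {k-1} {xb} {xa + D} (a + b) (sym xa+D≡xb) ⟩
      (xa + D + (a + b)) % k-1    ≡⟨ cong (_% k-1) (trans (+-assoc xa D (a + b)) (cong (xa +_) D+a+b≡k-1)) ⟩
      (xa + k-1) % k-1            ≡⟨ [m+n]%n≡m%n xa k-1 ⟩
      xa % k-1                    ≡⟨ m<n⇒m%n≡m xa<k-1 ⟩
      xa                          ∎
      where open ≡-Reasoning

    rotations≢ : ∀ i i′ c → 0 < c → c < k-1 → D + i′ ≡ i + c → (xa + i) % k-1 ≢ (xb + i′) % k-1
    rotations≢ i i′ c 0<c c<k-1 D+i′≡i+c eq =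
      rotation≢ ((xa + i) % k-1) c 0<c c<k-1 (m%n<n (xa + i) k-1) (begin
        (xa + i) % k-1               ≡⟨ eq ⟩
        (xb + i′) % k-1              ≡⟨ %-congˡ-+ {k-1} {xb} {xa + D} i′ (sym xa+D≡xb) ⟩
        (xa + D + i′) % k-1          ≡⟨ cong (_% k-1) (trans (+-assoc xa D i′) (cong (xa +_) D+i′≡i+c)) ⟩
        (xa + (i + c)) % k-1         ≡⟨ cong (_% k-1) (sym (+-assoc xa i c)) ⟩
        (xa + i + c) % k-1           ≡⟨ sym ([a%n+c]%n≡[a+c]%n {k-1} (xa + i) c) ⟩
        ((xa + i) % k-1 + c) % k-1   ∎)
      where open ≡-Reasoning

    realisedTwice-even : ∀ i₀ → D ≡ suc i₀ * 2 → RealisedTwice P xa P xb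
    realisedTwice-even i₀ D≡2i =
      realisedTwice-within ((xa + i) % k-1) ((xb + i′) % k-1) (m%n<n (xa + i) k-1) (m%n<n (xb + i′) k-1)
        (rotations≢ i i′ (suc m₀) (s≤s z≤n) m-1<k-1 D+i′≡i+m-1)
        (as-ba P 1 i₀ P<r 1<2 (<-trans ≤-refl i<m) refl (down-rotated xa i xa<k-1 i<m) refl
               (cong (_% k) (trans (up-rotated xa i i₀ i<m) (xa+a+b≡xb i i (sym D≡i+i)))))
        (as-ba P 0 i′ P<r 0<2 i′<m refl
               (cong (_% k) (trans (up-rotated xb i′ i′ (s≤s (s≤s (m∸n≤m m₀ i₀))))
                                   (xb+a+b≡xa i′ (suc i′) D+2i′+1≡k-1)))
               refl (down-rotated xb i′ xb<k-1 i′<m))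
      where
      i i′ : ℕ
      i  = suc i₀
      i′ = m₀ ∸ i₀
      D≡i+i : D ≡ i + i
      D≡i+i = trans D≡2i (solve 1 (λ a → (con 1 :+ a) :* con 2 := (con 1 :+ a) :+ (con 1 :+ a)) refl i₀)
      i<m : i < m
      i<m = *-cancelʳ-< 2 i m (<-trans (subst (_< k-1) D≡2i D<k-1) ≤-refl)
      i′<m : i′ < m
      i′<m = s≤s (≤-trans (m∸n≤m m₀ i₀) (n≤1+n m₀))
      i′+i≡m-1 : i′ + i ≡ suc m₀
      i′+i≡m-1 = trans (+-suc i′ i₀) (cong suc (m∸n+n≡m (s≤s⁻¹ (s≤s⁻¹ i<m))))
      D+i′≡i+m-1 : D + i′ ≡ i + suc m₀
      D+i′≡i+m-1 = trans (cong (_+ i′) D≡i+i) (trans (+-assoc i i i′) (cong (i +_) (trans (+-comm i i′) i′+i≡m-1)))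
      D+2i′+1≡k-1 : D + (i′ + suc i′) ≡ k-1
      D+2i′+1≡k-1 = trans (cong (_+ (i′ + suc i′)) D≡2i)
        (trans (solve 2 (λ a b → (con 1 :+ a) :* con 2 :+ (b :+ (con 1 :+ b))
                              := con 1 :+ (b :+ (con 1 :+ a)) :* con 2) refl i₀ i′)
               (cong (λ z → suc (z * 2)) i′+i≡m-1))

    realisedTwice-odd : ∀ i → D ≡ suc (i * 2) → RealisedTwice P xa P xb
    realisedTwice-odd i D≡2i+1 =
      realisedTwice-within ((xa + i) % k-1) ((xb + i′) % k-1) (m%n<n (xa + i) k-1) (m%n<n (xb + i′) k-1)
        (rotations≢ i i′ m (s≤s z≤n) m<k-1 D+i′≡i+m)
        (as-ab P 1 i P<r 1<2 i<m refl (down-rotated xa i xa<k-1 i<m) refl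
               (cong (_% k) (trans (up-rotated xa i i (s≤s (s≤s i≤m₀))) (xa+a+b≡xb i (suc i) (sym D≡i+i+1)))))
        (as-ab P 0 i′ P<r 0<2 i′<m refl
               (cong (_% k) (trans (up-rotated xb i′ (m₀ ∸ i) i′<m) (xb+a+b≡xa i′ i′ D+2i′≡k-1)))
               refl (down-rotated xb i′ xb<k-1 i′<m))
      where
      i′ : ℕ
      i′ = suc (m₀ ∸ i)
      D≡i+i+1 : D ≡ i + suc i
      D≡i+i+1 = trans D≡2i+1 (solve 1 (λ a → con 1 :+ a :* con 2 := a :+ (con 1 :+ a)) refl i)
      i≤m₀ : i ≤ m₀
      i≤m₀ = s≤s⁻¹ (*-cancelʳ-< 2 i (suc m₀) (s≤s⁻¹ (subst (_< k-1) D≡2i+1 D<k-1)))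
      i<m : i < m
      i<m = s≤s (≤-trans i≤m₀ (n≤1+n m₀))
      i′<m : i′ < m
      i′<m = s≤s (s≤s (m∸n≤m m₀ i))
      i′+i≡m-1 : i′ + i ≡ suc m₀
      i′+i≡m-1 = cong suc (m∸n+n≡m i≤m₀)
      D+i′≡i+m : D + i′ ≡ i + m
      D+i′≡i+m = trans (cong (_+ i′) D≡2i+1)
        (trans (solve 2 (λ a b → con 1 :+ a :* con 2 :+ b := a :+ (con 1 :+ (b :+ a))) refl i i′)
               (cong (λ z → i + suc z) i′+i≡m-1))
      D+2i′≡k-1 : D + (i′ + i′) ≡ k-1
      D+2i′≡k-1 = trans (cong (_+ (i′ + i′)) D≡2i+1)
        (trans (solve 2 (λ a b → con 1 :+ a :* con 2 :+ (b :+ b) := con 1 :+ (b :+ a) :* con 2) refl i i′)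
               (cong (λ z → suc (z * 2)) i′+i≡m-1))

  realisedTwice-finite : ∀ P xa xb → P < r → xa < k-1 → xb < k-1 → xa ≢ xb → RealisedTwice P xa P xb
  realisedTwice-finite P xa xb P<r xa<k-1 xb<k-1 xa≢xb = byParity (even⊎odd (xb ⊖[ k-1 ] xa))
    where
    open FinitePositions P<r xa<k-1 xb<k-1 (⊖<n {k-1} xb xa) (+-⊖ {k-1} xb xa)
    byParity : Σ ℕ (λ i → xb ⊖[ k-1 ] xa ≡ i * 2 ⊎ xb ⊖[ k-1 ] xa ≡ suc (i * 2)) → RealisedTwice P xa P xb
    byParity (zero   , inj₁ D≡0)    = ⊥-elim (xa≢xb (sym (trans (sym (m<n⇒m%n≡m xb<k-1))
                                        (trans (⊖≡0⇒%≡% {k-1} xb xa D≡0) (m<n⇒m%n≡m xa<k-1)))))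
    byParity (suc i₀ , inj₁ D≡2i)   = realisedTwice-even i₀ D≡2i
    byParity (i      , inj₂ D≡2i+1) = realisedTwice-odd i D≡2i+1

  realisedTwice-withinBlock : ∀ P xa xb → P < r → xa < k → xb < k → xa ≢ xb → RealisedTwice P xa P xb
  realisedTwice-withinBlock P xa xb P<r xa<k xb<k xa≢xb with xa <? k-1 | xb <? k-1
  ... | yes xa<k-1 | yes xb<k-1 = realisedTwice-finite P xa xb P<r xa<k-1 xb<k-1 xa≢xb
  ... | yes xa<k-1 | no xb≮k-1  =
    subst (RealisedTwice P xa P) (sym (x≡k-1 xb<k xb≮k-1)) (realisedTwice-to∞ P xa P<r xa<k-1)
  ... | no xa≮k-1  | yes xb<k-1 =
    subst (λ z → RealisedTwice P z P xb) (sym (x≡k-1 xa<k xa≮k-1)) (realisedTwice-from∞ P xb P<r xb<k-1)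
  ... | no xa≮k-1  | no xb≮k-1  = ⊥-elim (xa≢xb (trans (x≡k-1 xa<k xa≮k-1) (sym (x≡k-1 xb<k xb≮k-1))))

  realisedTwice : ∀ Pa xa Pb xb → Pa < r → Pb < r → xa < k → xb < k → ¬ (Pa ≡ Pb × xa ≡ xb) →
                  RealisedTwice Pa xa Pb xb
  realisedTwice Pa xa Pb xb Pa<r Pb<r xa<k xb<k ≢ with Pa Data.Nat.≟ Pb
  ... | no Pa≢Pb = realisedTwice-acrossBlocks Pa xa Pb xb Pa<r Pb<r xa<k Pa≢Pb
  ... | yes refl = realisedTwice-withinBlock Pa xa xb Pa<r xa<k xb<k (λ e → ≢ (refl , e))

  Joins : V → V → V × V → Set
  Joins x y e = e ≡ (x , y) ⊎ e ≡ (y , x)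

  JoinedIn : V → V → List (List V) → Set
  JoinedIn x y cs = Σ (List V) λ c → c ∈ cs × Σ (V × V) λ e → e ∈ cycleEdges c × Joins x y e

  JoinedIn-sym : ∀ {x y cs} → JoinedIn x y cs → JoinedIn y x cs
  JoinedIn-sym (c , c∈ , e , e∈ , joins) = c , c∈ , e , e∈ , Data.Sum.swap joins

  JoinedIn⇒1≤edgeUse : ∀ x y cs → JoinedIn x y cs → 1 ≤ edgeUse x y cs
  JoinedIn⇒1≤edgeUse x y cs (c , c∈ , e , e∈ , joins) =
    ≤-trans (1≤length-filter (matches? x y) (cycleEdges c) e∈ (matching joins))
            (≤-sum-map (λ c → length (filter (matches? x y) (cycleEdges c))) cs c∈)
    where
    matching : Joins x y e → ((proj₁ e ≡ x) × (proj₂ e ≡ y)) ⊎ ((proj₁ e ≡ y) × (proj₂ e ≡ x))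
    matching (inj₁ refl) = inj₁ (refl , refl)
    matching (inj₂ refl) = inj₂ (refl , refl)

  realised⇒JoinedIn : ∀ t φ s Pa xa Pb xb → 1 ≤ s → s ≤ w → Realises (typeOf φ) Pa xa Pb xb →
    JoinedIn (vertex (t + s) Pa xa) (vertex (t + (u ∸ s)) Pb xb) (cycles t φ)
  realised⇒JoinedIn t φ s Pa xa Pb xb 1≤s s≤w (as-ab P ε l P<r ε<2 l<m eP ex eB exb) =
    cycle t s τ P ε , cycle∈cycles t φ s P ε 1≤s s≤w P<r ε<2 , (a l , b l) ,
    subst ((a l , b l) ∈_) (sym (cycleEdges-alternating (suc m₀) a b))
          (∈-alternatingEdges-ab (suc m₀) a b (a 0) l (s≤s⁻¹ l<m)) ,
    inj₁ (cong₂ _,_ (vertex-cong {t + s} {P} {posA τ ε l} {t + s} {Pa} {xa} refl eP ex)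
                    (vertex-cong {t + (u ∸ s)} {blockB τ P} {posB τ ε l} {t + (u ∸ s)} {Pb} {xb} refl eB exb))
    where
    τ = typeOf φ
    a b : ℕ → V
    a = aVertex t s τ P ε
    b = bVertex t s τ P ε
  realised⇒JoinedIn t φ s Pa xa Pb xb 1≤s s≤w (as-ba P ε l P<r ε<2 l<m eP ex eB exb) =
    cycle t s τ P ε , cycle∈cycles t φ s P ε 1≤s s≤w P<r ε<2 , (b l , a (suc l)) ,
    subst ((b l , a (suc l)) ∈_) (sym (cycleEdges-alternating (suc m₀) a b))
          (∈-alternatingEdges-ba (suc m₀) a b (a 0) l (s≤s⁻¹ l<m) (cycle-closes t s τ P ε)) ,
    inj₂ (cong₂ _,_ (vertex-cong {t + (u ∸ s)} {blockB τ P} {posB τ ε l} {t + (u ∸ s)} {Pb} {xb} refl eB exb)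
                    (vertex-cong {t + s} {P} {posA τ ε (suc l)} {t + s} {Pa} {xa} refl eP ex))
    where
    τ = typeOf φ
    a b : ℕ → V
    a = aVertex t s τ P ε
    b = bVertex t s τ P ε

  JoinedTwice : ℕ → V → V → Set
  JoinedTwice t x y = Σ ℕ λ φ₁ → Σ ℕ λ φ₂ → φ₁ < g-1 × φ₂ < g-1 × φ₁ ≢ φ₂ ×
    JoinedIn x y (cycles t φ₁) × JoinedIn x y (cycles t φ₂)

  JoinedTwice-sym : ∀ {t x y} → JoinedTwice t x y → JoinedTwice t y x
  JoinedTwice-sym (φ₁ , φ₂ , φ₁< , φ₂< , φ₁≢φ₂ , j₁ , j₂) =
    φ₁ , φ₂ , φ₁< , φ₂< , φ₁≢φ₂ , JoinedIn-sym j₁ , JoinedIn-sym j₂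

  vertex-at : ∀ (v : V) p → p % u ≡ partOf v → vertex p (blockOf v) (positionOf v) ≡ v
  vertex-at v p e = trans (vertex-cong {p} {blockOf v} {positionOf v} {partOf v} {blockOf v} {positionOf v}
                                       (trans e (sym (m<n⇒m%n≡m (toℕ<n (proj₁ v))))) refl refl)
                          (vertex-decode v)

  joinedTwice : ∀ x y t s → 1 ≤ s → s ≤ w → (t + s) % u ≡ partOf x → (t + (u ∸ s)) % u ≡ partOf y →
                proj₂ x ≢ proj₂ y → JoinedTwice t x y
  joinedTwice x y t s 1≤s s≤w ex ey x≢y
    with realisedTwice (blockOf x) (positionOf x) (blockOf y) (positionOf y)
           (toℕ<n (proj₁ (remQuot {r} k (proj₂ x)))) (toℕ<n (proj₁ (remQuot {r} k (proj₂ y))))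
           (toℕ<n (proj₂ (remQuot {r} k (proj₂ x)))) (toℕ<n (proj₂ (remQuot {r} k (proj₂ y))))
           slots≢
    where
    slots≢ : ¬ (blockOf x ≡ blockOf y × positionOf x ≡ positionOf y)
    slots≢ (e₁ , e₂) = x≢y (trans (sym (combine-remQuot {r} k (proj₂ x)))
      (trans (cong₂ combine (toℕ-injective e₁) (toℕ-injective e₂)) (combine-remQuot {r} k (proj₂ y))))
  ... | φ₁ , φ₂ , φ₁< , φ₂< , φ₁≢φ₂ , real₁ , real₂ =
    φ₁ , φ₂ , φ₁< , φ₂< , φ₁≢φ₂ , joined φ₁ real₁ , joined φ₂ real₂
    where
    joined : ∀ φ → Realises (typeOf φ) (blockOf x) (positionOf x) (blockOf y) (positionOf y) →
             JoinedIn x y (cycles t φ)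
    joined φ real = subst₂ (λ a b → JoinedIn a b (cycles t φ)) (vertex-at x (t + s) ex) (vertex-at y (t + (u ∸ s)) ey)
                           (realised⇒JoinedIn t φ s _ _ _ _ 1≤s s≤w real)

  factorRows : List (List (PartialFactor k u g))
  factorRows = applyUpTo (λ t → applyUpTo (factor t) g-1) u

  factors : List (PartialFactor k u g)
  factors = concat factorRows

  JoinedTwice⇒2≤totalEdgeUse : ∀ x y t → t < u → JoinedTwice t x y → 2 ≤ totalEdgeUse x y factors
  JoinedTwice⇒2≤totalEdgeUse x y t t<u (φ₁ , φ₂ , φ₁< , φ₂< , φ₁≢φ₂ , j₁ , j₂) = begin
    2
      ≤⟨ +-mono-≤ (JoinedIn⇒1≤edgeUse x y (cycles t φ₁) j₁) (JoinedIn⇒1≤edgeUse x y (cycles t φ₂) j₂) ⟩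
    used (factor t φ₁) + used (factor t φ₂)
      ≤⟨ +-≤-sum-map-applyUpTo used (factor t) g-1 φ₁ φ₂ φ₁< φ₂< φ₁≢φ₂ ⟩
    sum (map used (applyUpTo (factor t) g-1))
      ≤⟨ ≤-sum-map (λ fs → sum (map used fs)) factorRows (∈-applyUpTo⁺ (λ t → applyUpTo (factor t) g-1) t<u) ⟩
    sum (map (λ fs → sum (map used fs)) factorRows)
      ≡⟨ sym (sum-map-concat used factorRows) ⟩
    totalEdgeUse x y factors ∎
    where
    open ≤-Reasoning
    used : PartialFactor k u g → ℕ
    used f = edgeUse x y (cyclesOf f)

  adjacent⇒2≤totalEdgeUse : ∀ x y → Adj x y → 2 ≤ totalEdgeUse x y factors
  adjacent⇒2≤totalEdgeUse x y (parts≢ , x≢y) =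
    viaCentre (parts-straddled (partOf x) (partOf y) (toℕ<n (proj₁ x)) (toℕ<n (proj₁ y)) (parts≢ ∘ toℕ-injective))
    where
    viaCentre : (Σ ℕ λ t → Σ ℕ λ s → t < u × 1 ≤ s × s ≤ w × Straddles t s (partOf x) (partOf y)) →
                2 ≤ totalEdgeUse x y factors
    viaCentre (t , s , t<u , 1≤s , s≤w , inj₁ (ex , ey)) =
      JoinedTwice⇒2≤totalEdgeUse x y t t<u (joinedTwice x y t s 1≤s s≤w ex ey x≢y)
    viaCentre (t , s , t<u , 1≤s , s≤w , inj₂ (ey , ex)) =
      JoinedTwice⇒2≤totalEdgeUse x y t t<u (JoinedTwice-sym {t} {y} {x} (joinedTwice y x t s 1≤s s≤w ey ex (x≢y ∘ sym)))

  totalLength-factors : totalLength factors ≡ u * (g * ((u ∸ 1) * (g ∸ 1)))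
  totalLength-factors = begin
    totalLength factors
      ≡⟨ sum-map-const (λ f → length (concat (cyclesOf f))) ((u ∸ 1) * g) factors
           (concat⁺ (applyUpTo⁺₂ (λ t → applyUpTo (factor t) g-1) u
                                 (λ t → applyUpTo⁺₂ (factor t) g-1 (length-cycles t)))) ⟩
    length factors * ((u ∸ 1) * g)
      ≡⟨ cong (_* ((u ∸ 1) * g)) (length-concat-applyUpTo (λ t → applyUpTo (factor t) g-1) g-1 u
                                    (λ t → length-applyUpTo (factor t) g-1)) ⟩
    (u * g-1) * ((u ∸ 1) * g)
      ≡⟨ solve 4 (λ u g a b → (u :* b) :* (a :* g) := u :* (g :* (a :* b))) refl u g (u ∸ 1) g-1 ⟩
    u * (g * ((u ∸ 1) * g-1)) ∎
    where open ≡-Reasoning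

  arcs : ARCS k u g 2
  arcs = arcs-fromLowerBound factors adjacent⇒2≤totalEdgeUse totalLength-factors

theorem4p3 : ∀ (k u g : ℕ) → 2 ∣ k → 4 ≤ k → ¬ (2 ∣ u) → 3 ≤ u → 0 < g → k ∣ g →
    ARCS k u g 2
theorem4p3 .(q * 2) u .(r * (q * 2)) (divides q refl) 4≤k u-odd _ 0<g (divides r refl) = arcs q r 4≤k 0<g
  where
  arcs : ∀ q r → 4 ≤ q * 2 → 0 < r * (q * 2) → ARCS (q * 2) u (r * (q * 2)) 2
  arcs zero           _        ()
  arcs (suc zero)     _        (s≤s (s≤s ()))
  arcs (suc (suc m₀)) zero     _ ()
  arcs (suc (suc m₀)) (suc r₀) _ _ with even⊎odd u
  ... | w , inj₁ u≡2w = ⊥-elim (u-odd (divides w u≡2w))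
  ... | w , inj₂ refl = Construction.arcs m₀ w r₀
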